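{- There are type $A$ crystal poset intervals with arbitrarily large Möbius function: for every integer $N$ there exist $n$, a partition $\lambda$, and elements $u\le v$ of the type $A_{n-1}$ crystal poset $B(\lambda)$ with $\mu(u,v)\ge N$.
   Context: The type $A_{n-1}$ crystal poset $B(\lambda)$ is the set of semistandard Young tableaux of shape $\lambda$ with entries in $\{1,\dots,n\}$, partially ordered by the transitive closure of $T\lessdot f_i(T)$, where $f_i$ is the crystal operator given by the signature rule: read the entries $i$ and $i+1$ of $T$ column by column from left to right, bottom to top within a column, write $+$ for $i$ and $-$ for $i+1$, repeatedly cancel adjacent pairs $-+$ to obtain $+^x-^y$; if $x>0$, $f_i(T)$ changes the $i$ corresponding to the rightmost uncancelled $+$ into $i+1$ (otherwise $f_i(T)=\mathbf 0$). $\mu$ denotes the Möbius function of this poset. -}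

module Defs where

open import Data.Nat as ℕ using (ℕ; zero; suc; _∸_; _≤ᵇ_; _<ᵇ_; _≡ᵇ_; _⊔_; _≤_; _<_)
open import Data.Bool using (Bool; true; false; _∧_; not; if_then_else_; T)
open import Data.List using (List; []; _∷_; [_]; map; length; reverse; upTo; concatMap;
  mapMaybe; filterᵇ; foldr; zip)
open import Data.Bool.ListAction using (all; any)
open import Data.Maybe using (Maybe; just; nothing; maybe; _>>=_)
import Data.Maybe as Maybe
open import Data.Product using (Σ; _×_; _,_; ∃)
open import Data.Integer as ℤ using (ℤ)
open import Relation.Binary.PropositionalEquality using (_≡_)
open import Relation.Nullary.Decidable using (⌊_⌋)
import Data.List.Properties as LP
open import Relation.Binary.Construct.Closure.ReflexiveTransitive using (Star)

-- Tableaux: a tableau is a list of rows, top row first (English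
-- convention); each row lists its entries from left to right.

Tableau : Set
Tableau = List (List ℕ)

_≟T_ : Tableau → Tableau → Bool
u ≟T v = ⌊ LP.≡-dec (LP.≡-dec ℕ._≟_) u v ⌋

isPartition : List ℕ → Bool
isPartition [] = true
isPartition (x ∷ []) = 1 ≤ᵇ x
isPartition (x ∷ y ∷ xs) = (y ≤ᵇ x) ∧ isPartition (y ∷ xs)

IsPartition : List ℕ → Set
IsPartition lam = T (isPartition lam)

weaklyInc : List ℕ → Bool
weaklyInc (x ∷ y ∷ xs) = (x ≤ᵇ y) ∧ weaklyInc (y ∷ xs)
weaklyInc _ = true

colStrict : List ℕ → List ℕ → Bool
colStrict upper lower =
  (length lower ≤ᵇ length upper) ∧ all (λ { (a , b) → a <ᵇ b }) (zip upper lower)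

colsStrict : Tableau → Bool
colsStrict (r ∷ s ∷ rs) = colStrict r s ∧ colsStrict (s ∷ rs)
colsStrict _ = true

eqListℕ : List ℕ → List ℕ → Bool
eqListℕ xs ys = ⌊ LP.≡-dec ℕ._≟_ xs ys ⌋

isSSYT : ℕ → List ℕ → Tableau → Bool
isSSYT n lam t =
  eqListℕ (map length t) lam
  ∧ all (all (λ x → (1 ≤ᵇ x) ∧ (x ≤ᵇ n))) t
  ∧ all weaklyInc t
  ∧ colsStrict t

InB : ℕ → List ℕ → Tableau → Set
InB n lam t = T (isSSYT n lam t)

words : ℕ → ℕ → List (List ℕ)
words n zero = [] ∷ []
words n (suc k) = concatMap (λ x → map (x ∷_) (words n k)) (map suc (upTo n))

fillings : ℕ → List ℕ → List Tableau
fillings n [] = [] ∷ []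
fillings n (k ∷ ks) = concatMap (λ r → map (r ∷_) (fillings n ks)) (words n k)

Bλ : ℕ → List ℕ → List Tableau
Bλ n lam = filterᵇ (isSSYT n lam) (fillings n lam)

nth : {A : Set} → List A → ℕ → Maybe A
nth [] _ = nothing
nth (x ∷ xs) zero = just x
nth (x ∷ xs) (suc k) = nth xs k

setAt : {A : Set} → List A → ℕ → (A → A) → List A
setAt [] _ g = []
setAt (x ∷ xs) zero g = g x ∷ xs
setAt (x ∷ xs) (suc k) g = x ∷ setAt xs k g

width : Tableau → ℕ
width t = foldr _⊔_ 0 (map length t)

-- reading word: columns left to right, each column bottom to top;
-- letters are recorded with their position (row , column , entry)
readingWord : Tableau → List (ℕ × ℕ × ℕ)
readingWord t =
  concatMap (λ c → concatMap (λ r →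
      maybe (λ x → [ (r , c , x) ]) []
            (nth t r >>= λ row → nth row c))
    (reverse (upTo (length t))))
  (upTo (width t))

-- scan the signature (+ for i, - for i+1) left to right, cancelling
-- pairs "-+"; p = number of currently uncancelled '-'.  An 'i' is an
-- uncancelled '+' iff no uncancelled '-' precedes it; returns the
-- position of the rightmost uncancelled '+'.
rightmostPlus : ℕ → ℕ → Maybe (ℕ × ℕ) → List (ℕ × ℕ × ℕ) → Maybe (ℕ × ℕ)
rightmostPlus i p cand [] = cand
rightmostPlus i p cand ((r , c , x) ∷ w) =
  if x ≡ᵇ i
  then (case′ p)
  else (if x ≡ᵇ suc i then rightmostPlus i (suc p) cand w
                       else rightmostPlus i p cand w)
  where
  case′ : ℕ → Maybe (ℕ × ℕ)
  case′ zero = rightmostPlus i zero (just (r , c)) w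
  case′ (suc q) = rightmostPlus i q cand w

f : ℕ → Tableau → Maybe Tableau
f i t = Maybe.map (λ { (r , c) → setAt t r (λ row → setAt row c (λ _ → suc i)) })
                  (rightmostPlus i 0 nothing (readingWord t))

Cover : ℕ → Tableau → Tableau → Set
Cover n t t' = Σ ℕ λ i → (1 ≤ i) × (i < n) × (f i t ≡ just t')

_≤[_]_ : Tableau → ℕ → Tableau → Set
u ≤[ n ] v = Star (Cover n) u v

succs : ℕ → Tableau → List Tableau
succs n t = mapMaybe (λ i → f i t) (map suc (upTo (n ∸ 1)))

reach : ℕ → ℕ → Tableau → List Tableau
reach n zero t = [ t ]
reach n (suc k) t = t ∷ concatMap (reach n k) (succs n t)

-- fuel |B(λ)| suffices: any path can be shortened to a simple one
leqᵇ : ℕ → List ℕ → Tableau → Tableau → Bool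
leqᵇ n lam u v = any (v ≟T_) (reach n (length (Bλ n lam)) u)

sumℤ : List ℤ → ℤ
sumℤ = foldr ℤ._+_ (ℤ.+ 0)

-- Möbius function: μ(u,u) = 1,  μ(u,v) = - Σ_{u ≤ z < v} μ(u,z) for u < v,
-- 0 if u ≰ v.  `fuel` bounds the recursion depth; |B(λ)|+1 suffices
-- since every chain in B(λ) has fewer than |B(λ)| covers.
muF : ℕ → List ℕ → ℕ → Tableau → Tableau → ℤ
muF n lam zero u v = ℤ.+ 0
muF n lam (suc k) u v =
  if u ≟T v then ℤ.+ 1
  else if leqᵇ n lam u v
  then ℤ.- sumℤ (map (muF n lam k u)
         (filterᵇ (λ z → leqᵇ n lam u z ∧ leqᵇ n lam z v ∧ not (z ≟T v)) (Bλ n lam)))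
  else ℤ.+ 0

μ : ℕ → List ℕ → Tableau → Tableau → ℤ
μ n lam u v = muF n lam (suc (length (Bλ n lam))) u v

{-# OPTIONS --safe #-}
-- The type A₃ crystal B(3,3) contains a 12-element interval [⊥, ⊤] with μ(⊥, ⊤) = 2.
-- Writing m two-row tableaux of this crystal side by side, the j-th one in the alphabet
-- {4j+1, …, 4j+4}, gives tableaux of shape (3m, 3m) with entries in {1, …, 4m}.  On them
-- f_{4j+i} with 1 ≤ i ≤ 3 acts on the j-th factor as f_i does, while f_{4j+4} moves a letter
-- into the next alphabet and therefore raises the sum of the block indices of the entries,
-- which is the same for all such concatenations.  So the interval from the concatenation u of
-- m copies of ⊥ to the concatenation v of m copies of ⊤ is the m-th power of [⊥, ⊤].  Every
-- lower interval [u, z] is then a product of lower intervals of [⊥, ⊤], so the recursion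
-- defining μ(u, -) is solved by the product of the values μ(⊥, -), and μ(u, v) = 2 ^ m.
module Submission where

open import Defs
open import Data.Nat as ℕ using (ℕ; zero; suc; _+_; _*_; _∸_; _^_; _≤_; _<_; z≤n; s≤s; _≡ᵇ_)
import Data.Nat.Properties as ℕ
open import Algebra.Properties.CommutativeSemigroup ℕ.+-commutativeSemigroup using (xy∙z≈xz∙y; xy∙z≈zy∙x)
open import Data.Nat.ListAction using (sum; product)
open import Data.Nat.ListAction.Properties using (sum-++)
open import Data.Nat.Tactic.RingSolver using (solve-∀)
open import Data.Integer as ℤ using (ℤ; 0ℤ; 1ℤ; -1ℤ; -_) renaming (_+_ to _+ℤ_; _*_ to _*ℤ_)
import Data.Integer.Properties as ℤ
open import Algebra.Properties.AbelianGroup ℤ.+-0-abelianGroup using (inverseʳ-unique)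
open import Data.List using (List; []; _∷_; [_]; _++_; map; length; foldr; filter; cartesianProductWith;
  concatMap; upTo; applyUpTo; mapMaybe; filterᵇ; zip; replicate)
import Data.List.Properties as List
open import Data.List.Membership.Propositional using (_∈_; find; lose)
open import Data.List.Membership.Propositional.Properties
  using (∈-filter⁺; ∈-filter⁻; ∈-cartesianProductWith⁺; ∈-cartesianProductWith⁻; ∈-concatMap⁺; ∈-concatMap⁻;
         ∈-map⁺; ∈-map⁻; ∈-upTo⁺; ∈-upTo⁻)
open import Data.List.Membership.Propositional.Properties.WithK using (unique∧set⇒bag)
open import Data.List.Relation.Unary.Any using (here; there)
open import Data.List.Relation.Unary.All as All using (All; []; _∷_)
import Data.List.Relation.Unary.All.Properties as AllP
open import Data.List.Relation.Unary.Any.Properties using (any⁺; any⁻)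
open import Data.List.Relation.Unary.Unique.Propositional using (Unique)
open import Data.List.Relation.Unary.AllPairs as AllPairs using (AllPairs; []; _∷_)
import Data.List.Relation.Unary.AllPairs.Properties as AllPairsP
import Data.List.Relation.Unary.Unique.Propositional.Properties as Unique
open import Data.List.Relation.Binary.Subset.Propositional using (_⊆_)
open import Data.List.Relation.Binary.Pointwise as Pointwise using (Pointwise; []; _∷_)
open import Data.List.Relation.Binary.Permutation.Propositional using (_↭_; ↭-sym; ↭⇒↭ₛ)
import Data.List.Relation.Binary.Permutation.Propositional.Properties as ↭
open ↭ using (↭-length)
open import Data.List.Relation.Binary.Permutation.Setoid.Properties using (foldr-commMonoid)
open import Data.List.Relation.Binary.BagAndSetEquality using (∼bag⇒↭)
open import Data.Bool using (Bool; true; false; T; T?; _∧_; not; if_then_else_)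
open import Data.Bool.Properties using (T-∧)
open import Data.Bool.ListAction using (all)
open import Data.Maybe as Maybe using (Maybe; just; nothing; maybe)
import Data.Maybe.Properties as Maybeₚ
open import Data.Maybe.Relation.Unary.All as MaybeAll using (just; nothing) renaming (All to MaybeAll)
open import Data.Product using (Σ; _×_; _,_; proj₁; proj₂; ∃; ∃₂)
open import Data.Product.Properties using () renaming (≡-dec to ×-≡-dec)
open import Data.Sum using (_⊎_; inj₁; inj₂)
open import Relation.Binary.Construct.Closure.ReflexiveTransitive using (Star; ε; _◅_; _◅◅_)
open import Function using (_∘_; _$_; id; _⇔_; mk⇔; Equivalence)
open import Relation.Binary.Definitions using (DecidableEquality)
open import Relation.Binary.PropositionalEquality hiding ([_])
open import Relation.Nullary using (Dec; yes; no; ¬?; contradiction)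
open import Relation.Nullary.Decidable
  using (_×-dec_; _⊎-dec_; _→-dec_; does; from-yes; toWitness; fromWitness; toWitnessFalse; fromWitnessFalse)

module _ {A : Set} where

  setAt-++ʳ : ∀ (xs : List A) ys c h → setAt (xs ++ ys) (length xs + c) h ≡ xs ++ setAt ys c h
  setAt-++ʳ []       ys c h = refl
  setAt-++ʳ (x ∷ xs) ys c h = cong (x ∷_) (setAt-++ʳ xs ys c h)

  setAt-++ˡ : ∀ (xs : List A) ys {c} h → c < length xs → setAt (xs ++ ys) c h ≡ setAt xs c h ++ ys
  setAt-++ˡ (x ∷ xs) ys {zero}  h _         = refl
  setAt-++ˡ (x ∷ xs) ys {suc c} h (s≤s c<n) = cong (x ∷_) (setAt-++ˡ xs ys h c<n)

  setAt-id : ∀ (xs : List A) c {h} → (∀ x → h x ≡ x) → setAt xs c h ≡ xs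
  setAt-id []       c       h≗id = refl
  setAt-id (x ∷ xs) zero    h≗id = cong (_∷ xs) (h≗id x)
  setAt-id (x ∷ xs) (suc c) h≗id = cong (x ∷_) (setAt-id xs c h≗id)

  nth-just⇒< : ∀ (xs : List A) {c x} → nth xs c ≡ just x → c < length xs
  nth-just⇒< (y ∷ xs) {zero}  _  = s≤s z≤n
  nth-just⇒< (y ∷ xs) {suc c} eq = s≤s (nth-just⇒< xs eq)

map-setAt : ∀ {A B : Set} (g : A → B) {h : A → A} {h′ : B → B} → (∀ x → g (h x) ≡ h′ (g x)) →
            ∀ xs c → map g (setAt xs c h) ≡ setAt (map g xs) c h′
map-setAt g comm []       c       = refl
map-setAt g comm (x ∷ xs) zero    = cong (_∷ map g xs) (comm x)
map-setAt g comm (x ∷ xs) (suc c) = cong (g x ∷_) (map-setAt g comm xs c)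

sum-map-setAt : ∀ {A : Set} (φ : A → ℕ) {h} xs {c x a b} → nth xs c ≡ just x → φ (h x) + a ≡ φ x + b →
                sum (map φ (setAt xs c h)) + a ≡ sum (map φ xs) + b
sum-map-setAt φ {h} (y ∷ xs) {zero} {a = a} {b} refl eq = begin
  φ (h y) + sum (map φ xs) + a ≡⟨ xy∙z≈xz∙y (φ (h y)) _ a ⟩
  φ (h y) + a + sum (map φ xs) ≡⟨ cong (_+ sum (map φ xs)) eq ⟩
  φ y + b + sum (map φ xs)     ≡⟨ xy∙z≈xz∙y (φ y) b _ ⟩
  φ y + sum (map φ xs) + b     ∎
  where open ≡-Reasoning
sum-map-setAt φ {h} (y ∷ xs) {suc c} {a = a} {b} nth≡ eq = begin
  φ y + sum (map φ (setAt xs c h)) + a   ≡⟨ ℕ.+-assoc (φ y) _ a ⟩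
  φ y + (sum (map φ (setAt xs c h)) + a) ≡⟨ cong (φ y +_) (sum-map-setAt φ xs nth≡ eq) ⟩
  φ y + (sum (map φ xs) + b)             ≡⟨ ℕ.+-assoc (φ y) _ b ⟨
  φ y + sum (map φ xs) + b               ∎
  where open ≡-Reasoning

++-injective : ∀ {A : Set} (xs ys : List A) {xs′ ys′} → length xs ≡ length ys →
  xs ++ xs′ ≡ ys ++ ys′ → xs ≡ ys × xs′ ≡ ys′
++-injective []       []       _    eq = refl , eq
++-injective (x ∷ xs) (y ∷ ys) len≡ eq with refl ← List.∷-injectiveˡ eq
  with refl , eq′ ← ++-injective xs ys (ℕ.suc-injective len≡) (List.∷-injectiveʳ eq) = refl , eq′

module _ {A : Set} {P : A → Set} where

  All-middle : ∀ as {x y} bs → All P (as ++ x ∷ bs) → P y → All P (as ++ y ∷ bs)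
  All-middle as bs all py = AllP.++⁺ (AllP.++⁻ˡ as all) (py ∷ All.tail (AllP.++⁻ʳ as all))

  All-middle-lookup : ∀ as {x} bs → All P (as ++ x ∷ bs) → P x
  All-middle-lookup as bs all = All.head (AllP.++⁻ʳ as all)

length-middle : ∀ {A : Set} (as : List A) {x y} bs → length (as ++ x ∷ bs) ≡ length (as ++ y ∷ bs)
length-middle as bs = trans (List.length-++ as) (sym (List.length-++ as))

concatMap-map-∷ : ∀ {A : Set} (xs : List A) (ys : List (List A)) →
  concatMap (λ x → map (x ∷_) ys) xs ≡ cartesianProductWith _∷_ xs ys
concatMap-map-∷ []       ys = refl
concatMap-map-∷ (x ∷ xs) ys = cong (map (x ∷_) ys ++_) (concatMap-map-∷ xs ys)

module _ {A B : Set} (g : A → Maybe B) where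

  ∈-mapMaybe⁺ : ∀ {xs x y} → x ∈ xs → g x ≡ just y → y ∈ mapMaybe g xs
  ∈-mapMaybe⁺ {x ∷ xs} (here refl) eq rewrite eq = here refl
  ∈-mapMaybe⁺ {x ∷ xs} (there x∈)  eq with g x
  ... | nothing = ∈-mapMaybe⁺ x∈ eq
  ... | just _  = there (∈-mapMaybe⁺ x∈ eq)

  ∈-mapMaybe⁻ : ∀ xs {y} → y ∈ mapMaybe g xs → ∃ λ x → x ∈ xs × g x ≡ just y
  ∈-mapMaybe⁻ (x ∷ xs) y∈ with g x in eq
  ... | nothing = let x′ , x′∈ , eq′ = ∈-mapMaybe⁻ xs y∈ in x′ , there x′∈ , eq′
  ... | just _ with y∈
  ...   | here refl = x , here refl , eq
  ...   | there y∈′ = let x′ , x′∈ , eq′ = ∈-mapMaybe⁻ xs y∈′ in x′ , there x′∈ , eq′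

module _ {A B : Set} {R : A → B → Set} where

  Pointwise-replicate⁻ : ∀ {xs y m} → Pointwise R xs (replicate m y) → All (λ x → R x y) xs × length xs ≡ m
  Pointwise-replicate⁻ {m = zero}  []          = [] , refl
  Pointwise-replicate⁻ {m = suc m} (r ∷ rs) = let all , len≡ = Pointwise-replicate⁻ rs in r ∷ all , cong suc len≡

  Pointwise-map⁻ʳ : ∀ {C : Set} {g : C → B} {xs ys} → Pointwise R xs (map g ys) → Pointwise (λ x y → R x (g y)) xs ys
  Pointwise-map⁻ʳ {ys = []}    []       = []
  Pointwise-map⁻ʳ {ys = _ ∷ _} (r ∷ rs) = r ∷ Pointwise-map⁻ʳ rs

  Pointwise-map⁺ʳ : ∀ {C : Set} {g : C → B} {xs ys} → Pointwise (λ x y → R x (g y)) xs ys → Pointwise R xs (map g ys)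
  Pointwise-map⁺ʳ []       = []
  Pointwise-map⁺ʳ (r ∷ rs) = r ∷ Pointwise-map⁺ʳ rs

  Pointwise-All⁺ : ∀ {x ys} → All (R x) ys → Pointwise R (replicate (length ys) x) ys
  Pointwise-All⁺ []       = []
  Pointwise-All⁺ (r ∷ rs) = r ∷ Pointwise-All⁺ rs

sumℤ-++ : ∀ xs ys → sumℤ (xs ++ ys) ≡ sumℤ xs +ℤ sumℤ ys
sumℤ-++ []       ys = sym (ℤ.+-identityˡ (sumℤ ys))
sumℤ-++ (x ∷ xs) ys = trans (cong (x +ℤ_) (sumℤ-++ xs ys)) (sym (ℤ.+-assoc x (sumℤ xs) (sumℤ ys)))

sumℤ-↭ : ∀ {xs ys} → xs ↭ ys → sumℤ xs ≡ sumℤ ys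
sumℤ-↭ p = foldr-commMonoid (setoid ℤ) ℤ.+-0-isCommutativeMonoid (↭⇒↭ₛ p)

sumℤ-map-*ˡ : ∀ {A : Set} a (F : A → ℤ) xs → sumℤ (map (λ x → a *ℤ F x) xs) ≡ a *ℤ sumℤ (map F xs)
sumℤ-map-*ˡ a F []       = sym (ℤ.*-zeroʳ a)
sumℤ-map-*ˡ a F (x ∷ xs) =
  trans (cong (a *ℤ F x +ℤ_) (sumℤ-map-*ˡ a F xs)) (sym (ℤ.*-distribˡ-+ a (F x) _))

sumℤ-cong : ∀ {A : Set} {F G : A → ℤ} xs → (∀ {x} → x ∈ xs → F x ≡ G x) → sumℤ (map F xs) ≡ sumℤ (map G xs)
sumℤ-cong []       F≗G = refl
sumℤ-cong (x ∷ xs) F≗G = cong₂ _+ℤ_ (F≗G (here refl)) (sumℤ-cong xs (F≗G ∘ there))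

productℤ : List ℤ → ℤ
productℤ = foldr _*ℤ_ 1ℤ

sumℤ-cartesianProductWith : ∀ {A B C : Set} (g : A → B → C) {H : C → ℤ} (F : A → ℤ) (G : B → ℤ) →
  (∀ a b → H (g a b) ≡ F a *ℤ G b) → ∀ xs ys →
  sumℤ (map H (cartesianProductWith g xs ys)) ≡ sumℤ (map F xs) *ℤ sumℤ (map G ys)
sumℤ-cartesianProductWith g F G H≡F*G []       ys = sym (ℤ.*-zeroˡ (sumℤ (map G ys)))
sumℤ-cartesianProductWith g {H} F G H≡F*G (x ∷ xs) ys = begin
  sumℤ (map H (map (g x) ys ++ cartesianProductWith g xs ys))
    ≡⟨ trans (cong sumℤ (List.map-++ H (map (g x) ys) _)) (sumℤ-++ (map H (map (g x) ys)) _) ⟩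
  sumℤ (map H (map (g x) ys)) +ℤ sumℤ (map H (cartesianProductWith g xs ys))
    ≡⟨ cong₂ _+ℤ_ row (sumℤ-cartesianProductWith g F G H≡F*G xs ys) ⟩
  F x *ℤ sumℤ (map G ys) +ℤ sumℤ (map F xs) *ℤ sumℤ (map G ys)
    ≡⟨ ℤ.*-distribʳ-+ (sumℤ (map G ys)) (F x) (sumℤ (map F xs)) ⟨
  (F x +ℤ sumℤ (map F xs)) *ℤ sumℤ (map G ys) ∎
  where
  open ≡-Reasoning
  row : sumℤ (map H (map (g x) ys)) ≡ F x *ℤ sumℤ (map G ys)
  row = trans (cong sumℤ (trans (sym (List.map-∘ ys)) (List.map-cong (H≡F*G x) ys))) (sumℤ-map-*ˡ (F x) G ys)

length-cartesianProductWith : ∀ {A B C : Set} (g : A → B → C) xs ys →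
  length (cartesianProductWith g xs ys) ≡ length xs * length ys
length-cartesianProductWith g []       ys = refl
length-cartesianProductWith g (x ∷ xs) ys = begin
  length (map (g x) ys ++ cartesianProductWith g xs ys)
    ≡⟨ List.length-++ (map (g x) ys) ⟩
  length (map (g x) ys) + length (cartesianProductWith g xs ys)
    ≡⟨ cong₂ _+_ (List.length-map (g x) ys) (length-cartesianProductWith g xs ys) ⟩
  length ys + length xs * length ys ∎
  where open ≡-Reasoning

cartesianProduct∷-unique : ∀ {A : Set} {xs : List A} {xss} → Unique xs → Unique xss → Unique (cartesianProductWith _∷_ xs xss)
cartesianProduct∷-unique = Unique.cartesianProductWith⁺ _∷_ List.∷-injective

choices : ∀ {A : Set} → List (List A) → List (List A)
choices = foldr (cartesianProductWith _∷_) [ [] ]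

module _ {A : Set} where

  ∈-choices⁺ : ∀ {xs : List A} {ls} → Pointwise _∈_ xs ls → xs ∈ choices ls
  ∈-choices⁺ []          = here refl
  ∈-choices⁺ (x∈l ∷ xs∈) = ∈-cartesianProductWith⁺ _∷_ x∈l (∈-choices⁺ xs∈)

  ∈-choices⁻ : ∀ {xs : List A} ls → xs ∈ choices ls → Pointwise _∈_ xs ls
  ∈-choices⁻ []       (here refl) = []
  ∈-choices⁻ (l ∷ ls) xs∈ with ∈-cartesianProductWith⁻ _∷_ l (choices ls) xs∈
  ... | _ , _ , x∈l , xs∈ls , refl = x∈l ∷ ∈-choices⁻ ls xs∈ls

  choices-unique : ∀ {ls : List (List A)} → All Unique ls → Unique (choices ls)
  choices-unique []       = [] ∷ []
  choices-unique (u ∷ us) = cartesianProduct∷-unique u (choices-unique us)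

  length-choices : ∀ (ls : List (List A)) → length (choices ls) ≡ product (map length ls)
  length-choices []       = refl
  length-choices (l ∷ ls) =
    trans (length-cartesianProductWith _∷_ l (choices ls)) (cong (length l *_) (length-choices ls))

  sumℤ-choices : ∀ (φ : A → ℤ) ls →
    sumℤ (map (productℤ ∘ map φ) (choices ls)) ≡ productℤ (map (sumℤ ∘ map φ) ls)
  sumℤ-choices φ []       = refl
  sumℤ-choices φ (l ∷ ls) =
    trans (sumℤ-cartesianProductWith _∷_ φ (productℤ ∘ map φ) (λ _ _ → refl) l (choices ls))
          (cong (sumℤ (map φ l) *ℤ_) (sumℤ-choices φ ls))

  unique-⇔⇒↭ : ∀ {xs ys : List A} → Unique xs → Unique ys → (∀ {z} → z ∈ xs ⇔ z ∈ ys) → xs ↭ ys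
  unique-⇔⇒↭ ux uy same = ∼bag⇒↭ (unique∧set⇒bag ux uy same)

  module _ (_≟_ : DecidableEquality A) where

    open import Data.List.Membership.DecPropositional _≟_ using (_∈?_)

    unique-⊆⇒length≤ : ∀ {xs ys : List A} → Unique xs → Unique ys → xs ⊆ ys → length xs ≤ length ys
    unique-⊆⇒length≤ {xs} {ys} ux uy xs⊆ys = begin
      length xs                   ≡⟨ ↭-length (unique-⇔⇒↭ ux (Unique.filter⁺ (_∈? xs) uy) same) ⟩
      length (filter (_∈? xs) ys) ≤⟨ List.length-filter (_∈? xs) ys ⟩
      length ys                   ∎
      where
      open ℕ.≤-Reasoning
      same : ∀ {z} → z ∈ xs ⇔ z ∈ filter (_∈? xs) ys
      same = mk⇔ (λ z∈xs → ∈-filter⁺ (_∈? xs) (xs⊆ys z∈xs) z∈xs) (proj₂ ∘ ∈-filter⁻ (_∈? xs) {xs = ys})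

module _ {A B : Set} {P : A → Set} (g : A → B) (injective : ∀ {x y} → P x → P y → g x ≡ g y → x ≡ y) where

  unique-map⁺ : ∀ {xs} → All P xs → Unique xs → Unique (map g xs)
  unique-map⁺ []         []             = []
  unique-map⁺ (px ∷ pxs) (x∉ ∷ unique) =
    All.tabulate (λ gy∈ gx≡gy → let y , y∈ , gy≡ = ∈-map⁻ g gy∈ in
      All.lookup x∉ y∈ (injective px (All.lookup pxs y∈) (trans gx≡gy gy≡)))
    ∷ unique-map⁺ pxs unique

module _ {A : Set} (_≟_ : DecidableEquality A) where

  unique-∈⇒↭-∷-filter : ∀ {x xs} → Unique xs → x ∈ xs → xs ↭ x ∷ filter (λ y → ¬? (y ≟ x)) xs
  unique-∈⇒↭-∷-filter {x} {xs} unique x∈ = unique-⇔⇒↭ unique unique′ (mk⇔ to from)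
    where
    others = filter (λ y → ¬? (y ≟ x)) xs
    unique′ : Unique (x ∷ others)
    unique′ = All.tabulate (λ y∈ x≡y → proj₂ (∈-filter⁻ (λ y → ¬? (y ≟ x)) {xs = xs} y∈) (sym x≡y))
            ∷ Unique.filter⁺ _ unique
    to : ∀ {z} → z ∈ xs → z ∈ x ∷ others
    to {z} z∈ with z ≟ x
    ... | yes refl = here refl
    ... | no z≢x   = there (∈-filter⁺ (λ y → ¬? (y ≟ x)) z∈ z≢x)
    from : ∀ {z} → z ∈ x ∷ others → z ∈ xs
    from (here refl) = x∈
    from (there z∈)  = proj₁ (∈-filter⁻ (λ y → ¬? (y ≟ x)) z∈)

data Path {A : Set} (R : A → A → Set) : A → A → ℕ → Set where
  ε   : ∀ {x} → Path R x x 0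
  _◅_ : ∀ {x y z ℓ} → R x y → Path R y z ℓ → Path R x z (suc ℓ)

module _ {A : Set} {R : A → A → Set} where

  Path⇒Star : ∀ {x y ℓ} → Path R x y ℓ → Star R x y
  Path⇒Star ε          = ε
  Path⇒Star (r ◅ path) = r ◅ Path⇒Star path

  _◅◅ᵖ_ : ∀ {x y z ℓ ℓ′} → Path R x y ℓ → Path R y z ℓ′ → Path R x z (ℓ + ℓ′)
  ε          ◅◅ᵖ path′ = path′
  (r ◅ path) ◅◅ᵖ path′ = r ◅ (path ◅◅ᵖ path′)

Path-map : ∀ {A B : Set} {R : A → A → Set} {S : B → B → Set} (g : A → B) →
  (∀ {x y} → R x y → S (g x) (g y)) → ∀ {x y ℓ} → Path R x y ℓ → Path S (g x) (g y) ℓ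
Path-map g R⇒S ε          = ε
Path-map g R⇒S (r ◅ path) = R⇒S r ◅ Path-map g R⇒S path

reachWithin : ∀ {A : Set} → (A → List A) → ℕ → A → List A
reachWithin next zero    x = [ x ]
reachWithin next (suc k) x = x ∷ concatMap (reachWithin next k) (next x)

module _ {A : Set} {R : A → A → Set} (next : A → List A) where

  reachWithin-sound : (∀ {x y} → y ∈ next x → R x y) →
    ∀ k x {y} → y ∈ reachWithin next k x → ∃ λ ℓ → ℓ ≤ k × Path R x y ℓ
  reachWithin-sound sound zero    x (here refl) = 0 , z≤n , ε
  reachWithin-sound sound (suc k) x (here refl) = 0 , z≤n , ε
  reachWithin-sound sound (suc k) x (there y∈) with find (∈-concatMap⁻ (reachWithin next k) y∈)
  ... | x′ , x′∈next , y∈′ with reachWithin-sound sound k x′ y∈′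
  ...   | ℓ , ℓ≤k , path = suc ℓ , s≤s ℓ≤k , sound x′∈next ◅ path

  reachWithin-complete : (∀ {x y} → R x y → y ∈ next x) →
    ∀ k x {y ℓ} → Path R x y ℓ → ℓ ≤ k → y ∈ reachWithin next k x
  reachWithin-complete complete zero    x ε                 _         = here refl
  reachWithin-complete complete (suc k) x ε                 _         = here refl
  reachWithin-complete complete (suc k) x (_◅_ {y = x′} r path) (s≤s ℓ≤k) =
    there (∈-concatMap⁺ (reachWithin next k) (lose (complete r) (reachWithin-complete complete k x′ path ℓ≤k)))

-- The signature rule

Word : Set
Word = List (ℕ × ℕ × ℕ)

letter : ℕ × ℕ × ℕ → ℕ
letter (_ , _ , x) = x

position : ℕ × ℕ × ℕ → ℕ × ℕ
position (r , c , _) = r , c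

Ignored : ℕ → ℕ → Set
Ignored i x = x ≢ i × x ≢ suc i

≢⇒≡ᵇ≡false : ∀ {x y} → x ≢ y → (x ≡ᵇ y) ≡ false
≢⇒≡ᵇ≡false {x} {y} x≢y with x ≡ᵇ y in eq
... | false = refl
... | true  = contradiction (ℕ.≡ᵇ⇒≡ x y (subst T (sym eq) _)) x≢y

<⇒ignored : ∀ {i x} → x < i → Ignored i x
<⇒ignored x<i = ℕ.<⇒≢ x<i , ℕ.<⇒≢ (ℕ.m<n⇒m<1+n x<i)

>⇒ignored : ∀ {i x} → suc i < x → Ignored i x
>⇒ignored i+1<x = ℕ.>⇒≢ (ℕ.<-trans (ℕ.n<1+n _) i+1<x) , ℕ.>⇒≢ i+1<x

rightmostPlus-ignored : ∀ i p cand {r c x} w → Ignored i x →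
  rightmostPlus i p cand ((r , c , x) ∷ w) ≡ rightmostPlus i p cand w
rightmostPlus-ignored i p cand w (x≢i , x≢i+1) rewrite ≢⇒≡ᵇ≡false x≢i | ≢⇒≡ᵇ≡false x≢i+1 = refl

rightmostPlus-ignoredˡ : ∀ i p cand w w′ → All (Ignored i ∘ letter) w →
  rightmostPlus i p cand (w ++ w′) ≡ rightmostPlus i p cand w′
rightmostPlus-ignoredˡ i p cand []      w′ []          = refl
rightmostPlus-ignoredˡ i p cand (_ ∷ w) w′ (ign ∷ igns) =
  trans (rightmostPlus-ignored i p cand (w ++ w′) ign) (rightmostPlus-ignoredˡ i p cand w w′ igns)

rightmostPlus-ignoredʳ : ∀ i p cand w w′ → All (Ignored i ∘ letter) w′ →
  rightmostPlus i p cand (w ++ w′) ≡ rightmostPlus i p cand w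
rightmostPlus-ignoredʳ i p cand [] w′ igns =
  trans (cong (rightmostPlus i p cand) (sym (List.++-identityʳ w′))) (rightmostPlus-ignoredˡ i p cand w′ [] igns)
rightmostPlus-ignoredʳ i p cand ((r , c , x) ∷ w) w′ igns with x ≡ᵇ i
... | true with p
...   | zero  = rightmostPlus-ignoredʳ i zero (just (r , c)) w w′ igns
...   | suc q = rightmostPlus-ignoredʳ i q cand w w′ igns
rightmostPlus-ignoredʳ i p cand ((r , c , x) ∷ w) w′ igns | false with x ≡ᵇ suc i
... | true  = rightmostPlus-ignoredʳ i (suc p) cand w w′ igns
... | false = rightmostPlus-ignoredʳ i p cand w w′ igns

shiftLetters : ℕ → Word → Word
shiftLetters s = map λ (r , c , x) → r , c , s + x

shiftPosition : ℕ → ℕ × ℕ → ℕ × ℕ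
shiftPosition k (r , c) = r , k + c

shiftPositions : ℕ → Word → Word
shiftPositions k = map λ (r , c , x) → r , k + c , x

+-≡ᵇ-cancelˡ : ∀ s a b → (s + a ≡ᵇ s + b) ≡ (a ≡ᵇ b)
+-≡ᵇ-cancelˡ zero    a b = refl
+-≡ᵇ-cancelˡ (suc s) a b = +-≡ᵇ-cancelˡ s a b

rightmostPlus-shiftLetters : ∀ s i p cand w →
  rightmostPlus (s + i) p cand (shiftLetters s w) ≡ rightmostPlus i p cand w
rightmostPlus-shiftLetters s i p cand [] = refl
rightmostPlus-shiftLetters s i p cand ((r , c , x) ∷ w)
  rewrite +-≡ᵇ-cancelˡ s x i | sym (ℕ.+-suc s i) | +-≡ᵇ-cancelˡ s x (suc i) with x ≡ᵇ i
... | true with p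
...   | zero  = rightmostPlus-shiftLetters s i zero (just (r , c)) w
...   | suc q = rightmostPlus-shiftLetters s i q cand w
rightmostPlus-shiftLetters s i p cand ((r , c , x) ∷ w) | false with x ≡ᵇ suc i
... | true  = rightmostPlus-shiftLetters s i (suc p) cand w
... | false = rightmostPlus-shiftLetters s i p cand w

rightmostPlus-shiftPositions : ∀ k i p cand w →
  rightmostPlus i p (Maybe.map (shiftPosition k) cand) (shiftPositions k w)
  ≡ Maybe.map (shiftPosition k) (rightmostPlus i p cand w)
rightmostPlus-shiftPositions k i p cand [] = refl
rightmostPlus-shiftPositions k i p cand ((r , c , x) ∷ w) with x ≡ᵇ i
... | true with p
...   | zero  = rightmostPlus-shiftPositions k i zero (just (r , c)) w
...   | suc q = rightmostPlus-shiftPositions k i q cand w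
rightmostPlus-shiftPositions k i p cand ((r , c , x) ∷ w) | false with x ≡ᵇ suc i
... | true  = rightmostPlus-shiftPositions k i (suc p) cand w
... | false = rightmostPlus-shiftPositions k i p cand w

rightmostPlus-All : ∀ {Q : ℕ × ℕ → Set} i p {cand} w → MaybeAll Q cand →
  All (λ e → letter e ≡ i → Q (position e)) w → MaybeAll Q (rightmostPlus i p cand w)
rightmostPlus-All i p []               q []       = q
rightmostPlus-All i p ((r , c , x) ∷ w) q (h ∷ hs) with x ≡ᵇ i in eq
... | true with p
...   | zero  = rightmostPlus-All i zero w (just (h (ℕ.≡ᵇ⇒≡ x i (subst T (sym eq) _)))) hs
...   | suc p′ = rightmostPlus-All i p′ w q hs
rightmostPlus-All i p ((r , c , x) ∷ w) q (h ∷ hs) | false with x ≡ᵇ suc i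
... | true  = rightmostPlus-All i (suc p) w q hs
... | false = rightmostPlus-All i p w q hs

-- Two-row tableaux

Column : Set
Column = ℕ × ℕ

twoRow : List Column → Tableau
twoRow cs = map proj₁ cs ∷ map proj₂ cs ∷ []

columnWord : ℕ → List Column → Word
columnWord k []             = []
columnWord k ((a , b) ∷ cs) = (1 , k , b) ∷ (0 , k , a) ∷ columnWord (suc k) cs

entry : ℕ → Column → Maybe ℕ
entry 0 (a , b) = just a
entry 1 (a , b) = just b
entry _ _       = nothing

setEntry : ℕ → ℕ → Column → Column
setEntry 0 y (a , b) = y , b
setEntry 1 y (a , b) = a , y
setEntry _ y col     = col

cell : List Column → ℕ × ℕ → Maybe ℕ
cell cs (r , c) = nth cs c Maybe.>>= entry r

setCell : List Column → ℕ × ℕ → ℕ → List Column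
setCell cs (r , c) y = setAt cs c (setEntry r y)

fCols : ℕ → List Column → Maybe (List Column)
fCols i cs = Maybe.map (λ pos → setCell cs pos (suc i)) (rightmostPlus i 0 nothing (columnWord 0 cs))

readingWord-twoRow : ∀ cs → readingWord (twoRow cs) ≡ columnWord 0 cs
readingWord-twoRow cs = trans (cong (λ w → concatMap (cellWord 0 cs) (upTo w)) width≡) (concatMap-cellWord 0 cs)
  where
  width≡ : width (twoRow cs) ≡ length cs
  width≡ rewrite List.length-map proj₁ cs | List.length-map proj₂ cs | ℕ.⊔-identityʳ (length cs) =
    ℕ.⊔-idem (length cs)

  cellWord : ℕ → List Column → ℕ → Word
  cellWord k cs c = maybe (λ x → [ 1 , k + c , x ]) [] (nth (map proj₂ cs) c)
                 ++ (maybe (λ x → [ 0 , k + c , x ]) [] (nth (map proj₁ cs) c) ++ [])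

  cellWord-suc : ∀ k col cs c → cellWord k (col ∷ cs) (suc c) ≡ cellWord (suc k) cs c
  cellWord-suc k col cs c rewrite ℕ.+-suc k c = refl

  concatMap-cellWord : ∀ k cs → concatMap (cellWord k cs) (upTo (length cs)) ≡ columnWord k cs
  concatMap-cellWord k []             = refl
  concatMap-cellWord k ((a , b) ∷ cs) rewrite ℕ.+-identityʳ k = cong (λ w → (1 , k , b) ∷ (0 , k , a) ∷ w) (begin
    concatMap (cellWord k ((a , b) ∷ cs)) (applyUpTo suc (length cs))
      ≡⟨ cong (concatMap _) (List.map-applyUpTo id suc (length cs)) ⟨
    concatMap (cellWord k ((a , b) ∷ cs)) (map suc (upTo (length cs)))
      ≡⟨ List.concatMap-map (cellWord k ((a , b) ∷ cs)) suc (upTo (length cs)) ⟩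
    concatMap (cellWord k ((a , b) ∷ cs) ∘ suc) (upTo (length cs))
      ≡⟨ List.concatMap-cong (cellWord-suc k (a , b) cs) (upTo (length cs)) ⟩
    concatMap (cellWord (suc k) cs) (upTo (length cs))
      ≡⟨ concatMap-cellWord (suc k) cs ⟩
    columnWord (suc k) cs ∎)
    where open ≡-Reasoning

setAt-twoRow : ∀ cs r c y → setAt (twoRow cs) r (λ row → setAt row c (λ _ → y)) ≡ twoRow (setCell cs (r , c) y)
setAt-twoRow cs 0 c y = cong₂ (λ top bot → top ∷ bot ∷ [])
  (sym (map-setAt proj₁ (λ _ → refl) cs c))
  (sym (trans (map-setAt proj₂ (λ _ → refl) cs c) (setAt-id (map proj₂ cs) c (λ _ → refl))))
setAt-twoRow cs 1 c y = cong₂ (λ top bot → top ∷ bot ∷ [])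
  (sym (trans (map-setAt proj₁ (λ _ → refl) cs c) (setAt-id (map proj₁ cs) c (λ _ → refl))))
  (sym (map-setAt proj₂ (λ _ → refl) cs c))
setAt-twoRow cs (suc (suc r)) c y = cong twoRow (sym (setAt-id cs c (λ _ → refl)))

f-twoRow : ∀ i cs → f i (twoRow cs) ≡ Maybe.map twoRow (fCols i cs)
f-twoRow i cs rewrite readingWord-twoRow cs with rightmostPlus i 0 nothing (columnWord 0 cs)
... | nothing      = refl
... | just (r , c) = cong just (setAt-twoRow cs r c (suc i))

f-twoRow-just : ∀ {i} cs {t} → f i (twoRow cs) ≡ just t → ∃ λ cs′ → fCols i cs ≡ just cs′ × t ≡ twoRow cs′
f-twoRow-just {i} cs f≡ with fCols i cs | trans (sym (f-twoRow i cs)) f≡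
... | just cs′ | refl = cs′ , refl , refl

zip-unzipColumns : ∀ (cs : List Column) → zip (map proj₁ cs) (map proj₂ cs) ≡ cs
zip-unzipColumns []             = refl
zip-unzipColumns ((a , b) ∷ cs) = cong ((a , b) ∷_) (zip-unzipColumns cs)

twoRow-injective : ∀ {cs ds} → twoRow cs ≡ twoRow ds → cs ≡ ds
twoRow-injective {cs} {ds} eq = begin
  cs                                ≡⟨ zip-unzipColumns cs ⟨
  zip (map proj₁ cs) (map proj₂ cs) ≡⟨ cong₂ zip (List.∷-injectiveˡ eq) (List.∷-injectiveˡ (List.∷-injectiveʳ eq)) ⟩
  zip (map proj₁ ds) (map proj₂ ds) ≡⟨ zip-unzipColumns ds ⟩
  ds                                ∎
  where open ≡-Reasoning

InRange : ℕ → ℕ → Set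
InRange n x = 1 ≤ x × x ≤ n

Entries : (ℕ → Set) → Column → Set
Entries P (a , b) = P a × P b

mapEntries : ∀ {P Q : ℕ → Set} → (∀ {x} → P x → Q x) → ∀ {cs} → All (Entries P) cs → All (Entries Q) cs
mapEntries P⇒Q = All.map (λ (pa , pb) → P⇒Q pa , P⇒Q pb)

_≼_ : Column → Column → Set
(a , b) ≼ (c , d) = a ≤ c × b ≤ d

ColumnStrict : Column → Set
ColumnStrict (a , b) = a < b

AllPairs⇒weaklyInc : ∀ {xs} → AllPairs _≤_ xs → T (weaklyInc xs)
AllPairs⇒weaklyInc []                               = _
AllPairs⇒weaklyInc (_ ∷ [])                         = _
AllPairs⇒weaklyInc {x ∷ y ∷ _} ((x≤y ∷ _) ∷ sorted) =
  Equivalence.from T-∧ (ℕ.≤⇒≤ᵇ x≤y , AllPairs⇒weaklyInc sorted)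

InB-twoRow : ∀ n cs → All (Entries (InRange n)) cs → AllPairs _≼_ cs → All ColumnStrict cs →
  InB n (length cs ∷ length cs ∷ []) (twoRow cs)
InB-twoRow n cs inRange rows columns = shape ∧ⁱ (entries ∧ⁱ (weak ∧ⁱ strict))
  where
  _∧ⁱ_ : ∀ {a b} → T a → T b → T (a ∧ b)
  ta ∧ⁱ tb = Equivalence.from T-∧ (ta , tb)
  t = twoRow cs
  shape : T (eqListℕ (map length t) (length cs ∷ length cs ∷ []))
  shape = fromWitness (cong₂ (λ p q → p ∷ q ∷ []) (List.length-map proj₁ cs) (List.length-map proj₂ cs))
  inRangeᵇ : ∀ {x} → InRange n x → T ((1 ℕ.≤ᵇ x) ∧ (x ℕ.≤ᵇ n))
  inRangeᵇ (1≤x , x≤n) = ℕ.≤⇒≤ᵇ 1≤x ∧ⁱ ℕ.≤⇒≤ᵇ x≤n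
  entries : T (all (all (λ x → (1 ℕ.≤ᵇ x) ∧ (x ℕ.≤ᵇ n))) t)
  entries = AllP.all⁻ _ (AllP.map⁺ (All.map (inRangeᵇ ∘ proj₁) inRange))
         ∧ⁱ (AllP.all⁻ _ (AllP.map⁺ (All.map (inRangeᵇ ∘ proj₂) inRange)) ∧ⁱ _)
  weak : T (all weaklyInc t)
  weak = AllPairs⇒weaklyInc (AllPairsP.map⁺ (AllPairs.map proj₁ rows))
      ∧ⁱ (AllPairs⇒weaklyInc (AllPairsP.map⁺ (AllPairs.map proj₂ rows)) ∧ⁱ _)
  strict : T (colsStrict t)
  strict = (ℕ.≤⇒≤ᵇ (ℕ.≤-reflexive (trans (List.length-map proj₂ cs) (sym (List.length-map proj₁ cs))))
         ∧ⁱ subst (T ∘ all _) (sym (zip-unzipColumns cs)) (AllP.all⁻ _ (All.map ℕ.<⇒<ᵇ columns))) ∧ⁱ _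

shiftColumn : ℕ → Column → Column
shiftColumn s (a , b) = s + a , s + b

shiftColumns : ℕ → List Column → List Column
shiftColumns s = map (shiftColumn s)

columnWord-++ : ∀ k xs ys → columnWord k (xs ++ ys) ≡ columnWord k xs ++ columnWord (k + length xs) ys
columnWord-++ k []             ys rewrite ℕ.+-identityʳ k = refl
columnWord-++ k ((a , b) ∷ xs) ys rewrite ℕ.+-suc k (length xs) =
  cong (λ w → (1 , k , b) ∷ (0 , k , a) ∷ w) (columnWord-++ (suc k) xs ys)

columnWord-shiftPositions : ∀ k j cs → columnWord (k + j) cs ≡ shiftPositions k (columnWord j cs)
columnWord-shiftPositions k j []             = refl
columnWord-shiftPositions k j ((a , b) ∷ cs) rewrite sym (ℕ.+-suc k j) =
  cong (λ w → (1 , k + j , b) ∷ (0 , k + j , a) ∷ w) (columnWord-shiftPositions k (suc j) cs)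

columnWord-shiftColumns : ∀ k s cs → columnWord k (shiftColumns s cs) ≡ shiftLetters s (columnWord k cs)
columnWord-shiftColumns k s []             = refl
columnWord-shiftColumns k s ((a , b) ∷ cs) =
  cong (λ w → (1 , k , s + b) ∷ (0 , k , s + a) ∷ w) (columnWord-shiftColumns (suc k) s cs)

columnWord-letters : ∀ {P : ℕ → Set} k {cs} → All (Entries P) cs → All (P ∘ letter) (columnWord k cs)
columnWord-letters k {[]}    []              = []
columnWord-letters k {_ ∷ _} ((pa , pb) ∷ ps) = pb ∷ pa ∷ columnWord-letters (suc k) ps

columnWord-cells : ∀ cs → All (λ e → cell cs (position e) ≡ just (letter e)) (columnWord 0 cs)
columnWord-cells []             = []
columnWord-cells ((a , b) ∷ cs) rewrite columnWord-shiftPositions 1 0 cs =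
  refl ∷ refl ∷ AllP.map⁺ (columnWord-cells cs)

rightmostPlus-cells : ∀ i cs → MaybeAll (λ pos → cell cs pos ≡ just i) (rightmostPlus i 0 nothing (columnWord 0 cs))
rightmostPlus-cells i cs =
  rightmostPlus-All i 0 (columnWord 0 cs) nothing
    (All.map (λ cell≡ letter≡i → trans cell≡ (cong just letter≡i)) (columnWord-cells cs))

cell-just⇒< : ∀ cs {r c x} → cell cs (r , c) ≡ just x → c < length cs
cell-just⇒< cs {r} {c} eq with nth cs c in nth≡
... | just _ = nth-just⇒< cs nth≡

rightmostPlus-middle : ∀ S i X g Z → All (Entries (_< S + i)) X → All (Entries (suc (S + i) <_)) Z →
  rightmostPlus (S + i) 0 nothing (columnWord 0 (X ++ shiftColumns S g ++ Z))
  ≡ Maybe.map (shiftPosition (length X)) (rightmostPlus i 0 nothing (columnWord 0 g))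
rightmostPlus-middle S i X g Z X< Z> = begin
  rp (columnWord 0 (X ++ Y ++ Z))
    ≡⟨ cong rp (columnWord-++ 0 X (Y ++ Z)) ⟩
  rp (columnWord 0 X ++ columnWord (length X) (Y ++ Z))
    ≡⟨ rightmostPlus-ignoredˡ (S + i) 0 nothing (columnWord 0 X) _
         (columnWord-letters 0 (All.map (λ (a< , b<) → <⇒ignored a< , <⇒ignored b<) X<)) ⟩
  rp (columnWord (length X) (Y ++ Z))
    ≡⟨ cong rp (columnWord-++ (length X) Y Z) ⟩
  rp (columnWord (length X) Y ++ columnWord (length X + length Y) Z)
    ≡⟨ rightmostPlus-ignoredʳ (S + i) 0 nothing (columnWord (length X) Y) _
         (columnWord-letters _ (All.map (λ (a> , b>) → >⇒ignored a> , >⇒ignored b>) Z>)) ⟩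
  rp (columnWord (length X) Y)
    ≡⟨ cong (λ k → rp (columnWord k Y)) (ℕ.+-identityʳ (length X)) ⟨
  rp (columnWord (length X + 0) Y)
    ≡⟨ cong rp (trans (columnWord-shiftPositions (length X) 0 Y)
                      (cong (shiftPositions (length X)) (columnWord-shiftColumns 0 S g))) ⟩
  rp (shiftPositions (length X) (shiftLetters S (columnWord 0 g)))
    ≡⟨ rightmostPlus-shiftPositions (length X) (S + i) 0 nothing (shiftLetters S (columnWord 0 g)) ⟩
  Maybe.map (shiftPosition (length X)) (rp (shiftLetters S (columnWord 0 g)))
    ≡⟨ cong (Maybe.map (shiftPosition (length X))) (rightmostPlus-shiftLetters S i 0 nothing (columnWord 0 g)) ⟩
  Maybe.map (shiftPosition (length X)) (rightmostPlus i 0 nothing (columnWord 0 g)) ∎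
  where
  open ≡-Reasoning
  Y = shiftColumns S g
  rp = rightmostPlus (S + i) 0 nothing

shiftColumn-setEntry : ∀ s r y col → shiftColumn s (setEntry r y col) ≡ setEntry r (s + y) (shiftColumn s col)
shiftColumn-setEntry s 0             y col = refl
shiftColumn-setEntry s 1             y col = refl
shiftColumn-setEntry s (suc (suc _)) y col = refl

setCell-middle : ∀ S X g Z r {c} y → c < length g →
  setCell (X ++ shiftColumns S g ++ Z) (r , length X + c) (S + y) ≡ X ++ shiftColumns S (setCell g (r , c) y) ++ Z
setCell-middle S X g Z r {c} y c<len = begin
  setAt (X ++ shiftColumns S g ++ Z) (length X + c) (setEntry r (S + y))
    ≡⟨ setAt-++ʳ X _ c _ ⟩
  X ++ setAt (shiftColumns S g ++ Z) c (setEntry r (S + y))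
    ≡⟨ cong (X ++_) (setAt-++ˡ (shiftColumns S g) Z _ (subst (c <_) (sym (List.length-map _ g)) c<len)) ⟩
  X ++ setAt (shiftColumns S g) c (setEntry r (S + y)) ++ Z
    ≡⟨ cong (λ cs → X ++ cs ++ Z) (map-setAt (shiftColumn S) (shiftColumn-setEntry S r y) g c) ⟨
  X ++ shiftColumns S (setAt g c (setEntry r y)) ++ Z ∎
  where open ≡-Reasoning

fCols-middle : ∀ S i X g Z → All (Entries (_< S + i)) X → All (Entries (suc (S + i) <_)) Z →
  fCols (S + i) (X ++ shiftColumns S g ++ Z) ≡ Maybe.map (λ g′ → X ++ shiftColumns S g′ ++ Z) (fCols i g)
fCols-middle S i X g Z X< Z> = begin
  Maybe.map (λ pos → setCell (X ++ shiftColumns S g ++ Z) pos (suc (S + i)))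
            (rightmostPlus (S + i) 0 nothing (columnWord 0 (X ++ shiftColumns S g ++ Z)))
    ≡⟨ cong (Maybe.map _) (rightmostPlus-middle S i X g Z X< Z>) ⟩
  Maybe.map (λ pos → setCell (X ++ shiftColumns S g ++ Z) pos (suc (S + i)))
            (Maybe.map (shiftPosition (length X)) (rightmostPlus i 0 nothing (columnWord 0 g)))
    ≡⟨ Maybeₚ.map-∘ (rightmostPlus i 0 nothing (columnWord 0 g)) ⟨
  Maybe.map (λ (r , c) → setCell (X ++ shiftColumns S g ++ Z) (r , length X + c) (suc (S + i)))
            (rightmostPlus i 0 nothing (columnWord 0 g))
    ≡⟨ Maybeₚ.map-cong-local (MaybeAll.map middle (rightmostPlus-cells i g)) ⟩
  Maybe.map (λ pos → X ++ shiftColumns S (setCell g pos (suc i)) ++ Z) (rightmostPlus i 0 nothing (columnWord 0 g))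
    ≡⟨ Maybeₚ.map-∘ (rightmostPlus i 0 nothing (columnWord 0 g)) ⟩
  Maybe.map (λ g′ → X ++ shiftColumns S g′ ++ Z) (fCols i g) ∎
  where
  open ≡-Reasoning
  middle : ∀ {pos} → cell g pos ≡ just i → let (r , c) = pos in
    setCell (X ++ shiftColumns S g ++ Z) (r , length X + c) (suc (S + i)) ≡ X ++ shiftColumns S (setCell g (r , c) (suc i)) ++ Z
  middle {r , c} cell≡ =
    trans (cong (setCell _ _) (sym (ℕ.+-suc S i))) (setCell-middle S X g Z r (suc i) (cell-just⇒< g cell≡))

-- Block tableaux

InAlphabet4 : List Column → Set
InAlphabet4 = All (Entries (InRange 4))

blocks : ℕ → List (List Column) → List Column
blocks s []       = []
blocks s (g ∷ gs) = shiftColumns s g ++ blocks (s + 4) gs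

offset-suc : ∀ s L → s + 4 + 4 * L ≡ s + 4 * suc L
offset-suc = solve-∀

blocks-++ : ∀ s as gs → blocks s (as ++ gs) ≡ blocks s as ++ blocks (s + 4 * length as) gs
blocks-++ s []       gs = cong (λ k → blocks k gs) (sym (ℕ.+-identityʳ s))
blocks-++ s (a ∷ as) gs = begin
  shiftColumns s a ++ blocks (s + 4) (as ++ gs)
    ≡⟨ cong (shiftColumns s a ++_) (blocks-++ (s + 4) as gs) ⟩
  shiftColumns s a ++ blocks (s + 4) as ++ blocks (s + 4 + 4 * length as) gs
    ≡⟨ cong (λ k → shiftColumns s a ++ blocks (s + 4) as ++ blocks k gs) (offset-suc s (length as)) ⟩
  shiftColumns s a ++ blocks (s + 4) as ++ blocks (s + 4 * suc (length as)) gs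
    ≡⟨ List.++-assoc (shiftColumns s a) (blocks (s + 4) as) _ ⟨
  (shiftColumns s a ++ blocks (s + 4) as) ++ blocks (s + 4 * suc (length as)) gs ∎
  where open ≡-Reasoning

shiftColumns-bounds : ∀ s {g} → InAlphabet4 g → All (Entries (λ x → s < x × x ≤ s + 4)) (shiftColumns s g)
shiftColumns-bounds s ok = AllP.map⁺ (mapEntries (λ (1≤x , x≤4) → ℕ.m<m+n s 1≤x , ℕ.+-monoʳ-≤ s x≤4) ok)

blocks-bounds : ∀ s gs → All InAlphabet4 gs →
  All (Entries (λ x → s < x × x ≤ s + 4 * length gs)) (blocks s gs)
blocks-bounds s []       []          = []
blocks-bounds s (g ∷ gs) (ok ∷ oks) =
  AllP.++⁺ (mapEntries inFirstBlock (shiftColumns-bounds s ok)) (mapEntries inLaterBlock (blocks-bounds (s + 4) gs oks))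
  where
  s+4≤ : s + 4 ≤ s + 4 * suc (length gs)
  s+4≤ = ℕ.+-monoʳ-≤ s (ℕ.*-monoʳ-≤ 4 (s≤s z≤n))
  inFirstBlock : ∀ {x} → s < x × x ≤ s + 4 → s < x × x ≤ s + 4 * suc (length gs)
  inFirstBlock (s<x , x≤) = s<x , ℕ.≤-trans x≤ s+4≤
  inLaterBlock : ∀ {x} → s + 4 < x × x ≤ s + 4 + 4 * length gs → s < x × x ≤ s + 4 * suc (length gs)
  inLaterBlock (s+4<x , x≤) =
    ℕ.≤-<-trans (ℕ.m≤m+n s 4) s+4<x , ℕ.≤-trans x≤ (ℕ.≤-reflexive (offset-suc s (length gs)))

f-blocks : ∀ as g bs {i} → All InAlphabet4 as → All InAlphabet4 bs → 1 ≤ i → i ≤ 3 →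
  fCols (4 * length as + i) (blocks 0 (as ++ g ∷ bs)) ≡ Maybe.map (λ g′ → blocks 0 (as ++ g′ ∷ bs)) (fCols i g)
f-blocks as g bs {i} oks-as oks-bs 1≤i i≤3 = begin
  fCols (S + i) (blocks 0 (as ++ g ∷ bs))
    ≡⟨ cong (fCols (S + i)) (blocks-++ 0 as (g ∷ bs)) ⟩
  fCols (S + i) (blocks 0 as ++ shiftColumns S g ++ blocks (S + 4) bs)
    ≡⟨ fCols-middle S i _ g _ below above ⟩
  Maybe.map (λ g′ → blocks 0 as ++ shiftColumns S g′ ++ blocks (S + 4) bs) (fCols i g)
    ≡⟨ Maybeₚ.map-cong (λ g′ → sym (blocks-++ 0 as (g′ ∷ bs))) (fCols i g) ⟩
  Maybe.map (λ g′ → blocks 0 (as ++ g′ ∷ bs)) (fCols i g) ∎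
  where
  open ≡-Reasoning
  S = 4 * length as
  below : All (Entries (_< S + i)) (blocks 0 as)
  below = mapEntries (λ (_ , x≤S) → ℕ.≤-<-trans x≤S (ℕ.m<m+n S 1≤i)) (blocks-bounds 0 as oks-as)
  above : All (Entries (suc (S + i) <_)) (blocks (S + 4) bs)
  above = mapEntries (λ (S+4<x , _) → ℕ.≤-<-trans S+i+1≤S+4 S+4<x) (blocks-bounds (S + 4) bs oks-bs)
    where
    S+i+1≤S+4 : suc (S + i) ≤ S + 4
    S+i+1≤S+4 = subst (_≤ S + 4) (ℕ.+-suc S i) (ℕ.+-monoʳ-≤ S (s≤s i≤3))

blockTableau : List (List Column) → Tableau
blockTableau gs = twoRow (blocks 0 gs)

Cover₄ : List Column → List Column → Set
Cover₄ g g′ = ∃ λ i → 1 ≤ i × i ≤ 3 × fCols i g ≡ just g′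

f-blockTableau : ∀ as g bs {i} → All InAlphabet4 as → All InAlphabet4 bs → 1 ≤ i → i ≤ 3 →
  f (4 * length as + i) (blockTableau (as ++ g ∷ bs)) ≡ Maybe.map (λ g′ → blockTableau (as ++ g′ ∷ bs)) (fCols i g)
f-blockTableau as g bs ok-as ok-bs 1≤i i≤3 = begin
  f _ (blockTableau (as ++ g ∷ bs))
    ≡⟨ f-twoRow _ (blocks 0 (as ++ g ∷ bs)) ⟩
  Maybe.map twoRow (fCols _ (blocks 0 (as ++ g ∷ bs)))
    ≡⟨ cong (Maybe.map twoRow) (f-blocks as g bs ok-as ok-bs 1≤i i≤3) ⟩
  Maybe.map twoRow (Maybe.map (λ g′ → blocks 0 (as ++ g′ ∷ bs)) (fCols _ g))
    ≡⟨ Maybeₚ.map-∘ (fCols _ g) ⟨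
  Maybe.map (λ g′ → blockTableau (as ++ g′ ∷ bs)) (fCols _ g) ∎
  where open ≡-Reasoning

-- block x = ⌊(x ∸ 1) / 4⌋ is the index of the alphabet {4j+1, …, 4j+4} containing x.
block : ℕ → ℕ
block (suc (suc (suc (suc (suc x))))) = suc (block (suc x))
block _                               = 0

block-≤-suc : ∀ x → block x ≤ block (suc x)
block-≤-suc 0                                 = z≤n
block-≤-suc 1                                 = z≤n
block-≤-suc 2                                 = z≤n
block-≤-suc 3                                 = z≤n
block-≤-suc 4                                 = z≤n
block-≤-suc (suc (suc (suc (suc (suc x))))) = s≤s (block-≤-suc (suc x))

block-offset : ∀ j {x} → InRange 4 x → block (4 * j + x) ≡ j
block-offset zero    {1} _ = refl
block-offset zero    {2} _ = refl
block-offset zero    {3} _ = refl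
block-offset zero    {4} _ = refl
block-offset zero    {suc (suc (suc (suc (suc _))))} (_ , s≤s (s≤s (s≤s (s≤s ()))))
block-offset (suc j) {suc x} (_ , x<4) = begin
  block (4 * suc j + suc x)     ≡⟨ cong block (shift j x) ⟩
  suc (block (suc (4 * j + x))) ≡⟨ cong (suc ∘ block) (ℕ.+-suc (4 * j) x) ⟨
  suc (block (4 * j + suc x))   ≡⟨ cong suc (block-offset j (s≤s z≤n , x<4)) ⟩
  suc j                         ∎
  where
  open ≡-Reasoning
  shift : ∀ j x → 4 * suc j + suc x ≡ suc (suc (suc (suc (suc (4 * j + x)))))
  shift = solve-∀

columnPotential : Column → ℕ
columnPotential (a , b) = block a + block b

potential : List Column → ℕ
potential cs = sum (map columnPotential cs)

potential-fCols : ∀ i cs {cs′} → fCols i cs ≡ just cs′ → potential cs′ + block i ≡ potential cs + block (suc i)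
potential-fCols i cs eq with rightmostPlus i 0 nothing (columnWord 0 cs) | rightmostPlus-cells i cs
... | just (r , c) | just cell≡ with refl ← eq with nth cs c in nth≡
... | just col = sum-map-setAt columnPotential cs nth≡ (setEntry-potential r col cell≡)
  where
  setEntry-potential : ∀ r col → entry r col ≡ just i →
    columnPotential (setEntry r (suc i) col) + block i ≡ columnPotential col + block (suc i)
  setEntry-potential 0 (a , b) refl = xy∙z≈zy∙x (block (suc i)) (block b) (block i)
  setEntry-potential 1 (a , b) refl = xy∙z≈xz∙y (block a) (block (suc i)) (block i)

potential-≤-fCols : ∀ i cs {cs′} → fCols i cs ≡ just cs′ → potential cs ≤ potential cs′
potential-≤-fCols i cs {cs′} eq = ℕ.+-cancelʳ-≤ (block i) (potential cs) (potential cs′) (begin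
  potential cs + block i       ≤⟨ ℕ.+-monoʳ-≤ (potential cs) (block-≤-suc i) ⟩
  potential cs + block (suc i) ≡⟨ potential-fCols i cs eq ⟨
  potential cs′ + block i      ∎)
  where open ℕ.≤-Reasoning

potential-<-fCols-boundary : ∀ j cs {cs′} → fCols (4 * j + 4) cs ≡ just cs′ → potential cs < potential cs′
potential-<-fCols-boundary j cs {cs′} eq = ℕ.+-cancelʳ-≤ (block i) (suc (potential cs)) (potential cs′) (begin
  suc (potential cs) + block i ≡⟨ cong (suc (potential cs) +_) block-i ⟩
  suc (potential cs) + j       ≡⟨ ℕ.+-suc (potential cs) j ⟨
  potential cs + suc j         ≡⟨ cong (potential cs +_) block-suc-i ⟨
  potential cs + block (suc i) ≡⟨ potential-fCols i cs eq ⟨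
  potential cs′ + block i      ∎)
  where
  open ℕ.≤-Reasoning
  i = 4 * j + 4
  block-i : block i ≡ j
  block-i = block-offset j (s≤s z≤n , ℕ.≤-refl)
  next : ∀ j → suc (4 * j + 4) ≡ 4 * suc j + 1
  next = solve-∀
  block-suc-i : block (suc i) ≡ suc j
  block-suc-i = trans (cong block (next j)) (block-offset (suc j) (ℕ.≤-refl , s≤s z≤n))

potential-++ : ∀ xs ys → potential (xs ++ ys) ≡ potential xs + potential ys
potential-++ xs ys = trans (cong sum (List.map-++ columnPotential xs ys)) (sum-++ (map columnPotential xs) _)

potential-shiftColumns : ∀ j {g} → InAlphabet4 g → potential (shiftColumns (4 * j) g) ≡ (j + j) * length g
potential-shiftColumns j []                      = sym (ℕ.*-zeroʳ (j + j))
potential-shiftColumns j {_ ∷ g} ((a∈ , b∈) ∷ ok) = begin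
  columnPotential (shiftColumn (4 * j) _) + potential (shiftColumns (4 * j) g)
    ≡⟨ cong₂ _+_ (cong₂ _+_ (block-offset j a∈) (block-offset j b∈)) (potential-shiftColumns j ok) ⟩
  j + j + (j + j) * length g
    ≡⟨ ℕ.*-suc (j + j) (length g) ⟨
  (j + j) * suc (length g) ∎
  where open ≡-Reasoning

potential-blocks : ∀ j {gs hs} → All InAlphabet4 gs → All InAlphabet4 hs →
  Pointwise (λ g h → length g ≡ length h) gs hs → potential (blocks (4 * j) gs) ≡ potential (blocks (4 * j) hs)
potential-blocks j []           []           []             = refl
potential-blocks j {g ∷ gs} {h ∷ hs} (okg ∷ okgs) (okh ∷ okhs) (len≡ ∷ lens≡) = begin
  potential (shiftColumns (4 * j) g ++ blocks (4 * j + 4) gs)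
    ≡⟨ potential-++ (shiftColumns (4 * j) g) _ ⟩
  potential (shiftColumns (4 * j) g) + potential (blocks (4 * j + 4) gs)
    ≡⟨ cong₂ _+_ first rest ⟩
  potential (shiftColumns (4 * j) h) + potential (blocks (4 * j + 4) hs)
    ≡⟨ potential-++ (shiftColumns (4 * j) h) _ ⟨
  potential (shiftColumns (4 * j) h ++ blocks (4 * j + 4) hs) ∎
  where
  open ≡-Reasoning
  first : potential (shiftColumns (4 * j) g) ≡ potential (shiftColumns (4 * j) h)
  first = trans (potential-shiftColumns j okg) (trans (cong ((j + j) *_) len≡) (sym (potential-shiftColumns j okh)))
  rest : potential (blocks (4 * j + 4) gs) ≡ potential (blocks (4 * j + 4) hs)
  rest = subst (λ s → potential (blocks s gs) ≡ potential (blocks s hs))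
               (trans (ℕ.*-suc 4 j) (ℕ.+-comm 4 (4 * j))) (potential-blocks (suc j) okgs okhs lens≡)

data IndexPosition {A : Set} (gs : List A) (i : ℕ) : Set where
  boundary : ∀ j → i ≡ 4 * j + 4 → IndexPosition gs i
  inside   : ∀ as g bs i′ → gs ≡ as ++ g ∷ bs → i ≡ 4 * length as + i′ → 1 ≤ i′ → i′ ≤ 3 → IndexPosition gs i

indexPosition : ∀ {A : Set} (gs : List A) i → 1 ≤ i → i < 4 * length gs → IndexPosition gs i
indexPosition (g ∷ gs) 1 _ _ = inside [] g gs 1 refl refl ℕ.≤-refl (s≤s z≤n)
indexPosition (g ∷ gs) 2 _ _ = inside [] g gs 2 refl refl (s≤s z≤n) (s≤s (s≤s z≤n))
indexPosition (g ∷ gs) 3 _ _ = inside [] g gs 3 refl refl (s≤s z≤n) ℕ.≤-refl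
indexPosition (g ∷ gs) 4 _ _ = boundary 0 refl
indexPosition (g ∷ gs) (suc (suc (suc (suc (suc k))))) _ k+5<
  with indexPosition gs (suc k) (s≤s z≤n) (ℕ.+-cancelˡ-< 4 (suc k) _ (subst (4 + suc k <_) (ℕ.*-suc 4 (length gs)) k+5<))
... | boundary j eq = boundary (suc j) (trans (cong (4 +_) eq) (nextBoundary j))
  where
  nextBoundary : ∀ j → 4 + (4 * j + 4) ≡ 4 * suc j + 4
  nextBoundary = solve-∀
... | inside as g′ bs i′ split eq 1≤i′ i′≤3 =
  inside (g ∷ as) g′ bs i′ (cong (g ∷_) split) (trans (cong (4 +_) eq) (nextBlock (length as) i′)) 1≤i′ i′≤3
  where
  nextBlock : ∀ L i′ → 4 + (4 * L + i′) ≡ 4 * suc L + i′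
  nextBlock = solve-∀

star-twoRow : ∀ {n} cs {t} → Star (Cover n) (twoRow cs) t → ∃ λ cs′ → t ≡ twoRow cs′ × potential cs ≤ potential cs′
star-twoRow cs ε                             = cs , refl , ℕ.≤-refl
star-twoRow cs ((i , _ , _ , f≡) ◅ covers) with f-twoRow-just cs f≡
... | cs₁ , eq , refl with star-twoRow cs₁ covers
...   | cs′ , refl , ≤cs′ = cs′ , refl , ℕ.≤-trans (potential-≤-fCols i cs eq) ≤cs′

star-potential : ∀ {n cs cs′} → Star (Cover n) (twoRow cs) (twoRow cs′) → potential cs ≤ potential cs′
star-potential {cs = cs} steps with star-twoRow cs steps
... | _ , eq , ≤cs″ rewrite twoRow-injective eq = ≤cs″

cover-blocks : ∀ gs → All InAlphabet4 gs → ∀ {t} → Cover (4 * length gs) (blockTableau gs) t →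
    (∃ λ cs′ → t ≡ twoRow cs′ × potential (blocks 0 gs) < potential cs′)
  ⊎ (∃₂ λ as bs → ∃₂ λ g g′ → gs ≡ as ++ g ∷ bs × Cover₄ g g′ × t ≡ blockTableau (as ++ g′ ∷ bs))
cover-blocks gs ok (i , 1≤i , i< , f≡) with indexPosition gs i 1≤i i<
... | boundary j refl with f-twoRow-just (blocks 0 gs) f≡
...   | cs′ , eq , refl = inj₁ (cs′ , refl , potential-<-fCols-boundary j (blocks 0 gs) eq)
cover-blocks gs ok (i , 1≤i , i< , f≡) | inside as g bs i′ refl refl 1≤i′ i′≤3
  with fCols i′ g in eq
     | trans (sym (f-blockTableau as g bs (AllP.++⁻ˡ as ok) (All.tail (AllP.++⁻ʳ as ok)) 1≤i′ i′≤3)) f≡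
... | just g′ | refl = inj₂ (as , bs , g , g′ , refl , (i′ , 1≤i′ , i′≤3 , eq) , refl)

shiftColumns-injective : ∀ s {cs ds} → shiftColumns s cs ≡ shiftColumns s ds → cs ≡ ds
shiftColumns-injective s = List.map-injective λ eq →
  cong₂ _,_ (ℕ.+-cancelˡ-≡ s _ _ (cong proj₁ eq)) (ℕ.+-cancelˡ-≡ s _ _ (cong proj₂ eq))

blocks-injective : ∀ s {gs hs} → Pointwise (λ g h → length g ≡ length h) gs hs → blocks s gs ≡ blocks s hs → gs ≡ hs
blocks-injective s []                       _  = refl
blocks-injective s {g ∷ gs} {h ∷ hs} (len≡ ∷ lens≡) eq
  with shifted≡ , rest≡ ← ++-injective (shiftColumns s g) (shiftColumns s h)
                            (trans (List.length-map _ g) (trans len≡ (sym (List.length-map _ h)))) eq =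
  cong₂ _∷_ (shiftColumns-injective s shifted≡) (blocks-injective (s + 4) lens≡ rest≡)

cover-lift : ∀ {n} as bs {g g′} → All InAlphabet4 as → All InAlphabet4 bs → 4 * length as + 3 < n → Cover₄ g g′ →
  Cover n (blockTableau (as ++ g ∷ bs)) (blockTableau (as ++ g′ ∷ bs))
cover-lift as bs {g} ok-as ok-bs bound (i , 1≤i , i≤3 , eq) =
  4 * length as + i , ℕ.≤-trans 1≤i (ℕ.m≤n+m i _) , ℕ.≤-<-trans (ℕ.+-monoʳ-≤ _ i≤3) bound ,
  trans (f-blockTableau as g bs ok-as ok-bs 1≤i i≤3) (cong (Maybe.map _) eq)

ShortPath : List Column → List Column → Set
ShortPath g h = ∃ λ ℓ → ℓ ≤ 4 × Path Cover₄ g h ℓ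

pointwise-lift : ∀ {n} as {gs hs} → All InAlphabet4 as → All InAlphabet4 gs → All InAlphabet4 hs →
  4 * length (as ++ gs) ≤ n → Pointwise ShortPath gs hs →
  ∃ λ ℓ → ℓ ≤ 4 * length gs × Path (Cover n) (blockTableau (as ++ gs)) (blockTableau (as ++ hs)) ℓ
pointwise-lift as ok-as [] [] _ [] = 0 , z≤n , ε
pointwise-lift {n} as {g ∷ gs} {h ∷ hs} ok-as (_ ∷ okgs) (okh ∷ okhs) bound ((ℓ₁ , ℓ₁≤4 , path₁) ∷ paths)
  with ℓ₂ , ℓ₂≤ , path₂ ← pointwise-lift (as ++ [ h ]) (AllP.++⁺ ok-as (okh ∷ [])) okgs okhs
         (subst (λ L → 4 * L ≤ n) (trans (length-middle as gs) (cong length (sym (List.++-assoc as [ h ] gs)))) bound) paths =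
  ℓ₁ + ℓ₂ ,
  subst (ℓ₁ + ℓ₂ ≤_) (sym (ℕ.*-suc 4 (length gs))) (ℕ.+-mono-≤ ℓ₁≤4 ℓ₂≤) ,
  Path-map (λ x → blockTableau (as ++ x ∷ gs))
           (cover-lift as gs ok-as okgs (ℕ.<-≤-trans (block-last (length as) (length gs)) bound′)) path₁
  ◅◅ᵖ subst₂ (λ x y → Path (Cover n) (blockTableau x) (blockTableau y) ℓ₂)
             (List.++-assoc as [ h ] gs) (List.++-assoc as [ h ] hs) path₂
  where
  bound′ : 4 * (length as + suc (length gs)) ≤ n
  bound′ = subst (λ L → 4 * L ≤ n) (List.length-++ as) bound
  block-last : ∀ a b → 4 * a + 3 < 4 * (a + suc b)
  block-last a b = begin-strict
    4 * a + 3          <⟨ ℕ.+-monoʳ-< (4 * a) (ℕ.n<1+n 3) ⟩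
    4 * a + 4          ≤⟨ ℕ.m≤m+n (4 * a + 4) (4 * b) ⟩
    4 * a + 4 + 4 * b  ≡⟨ spread a b ⟩
    4 * (a + suc b)    ∎
    where
    open ℕ.≤-Reasoning
    spread : ∀ a b → 4 * a + 4 + 4 * b ≡ 4 * (a + suc b)
    spread = solve-∀

-- The crystal poset and its Möbius function

succs-sound : ∀ n t {t′} → t′ ∈ succs n t → Cover n t t′
succs-sound n t t′∈ with ∈-mapMaybe⁻ (λ i → f i t) (map suc (upTo (n ∸ 1))) t′∈
... | i , i∈ , f≡ with ∈-map⁻ suc i∈
...   | j , j∈ , refl = suc j , s≤s z≤n , suc-j<n n (∈-upTo⁻ j∈) , f≡
  where
  suc-j<n : ∀ n → j < n ∸ 1 → suc j < n
  suc-j<n (suc n) j<n = s≤s j<n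

succs-complete : ∀ n t {t′} → Cover n t t′ → t′ ∈ succs n t
succs-complete n t (suc j , _ , j+1<n , f≡) =
  ∈-mapMaybe⁺ (λ i → f i t) (∈-map⁺ suc (∈-upTo⁺ (ℕ.∸-monoˡ-< j+1<n (s≤s z≤n)))) f≡

reach≡reachWithin : ∀ n k t → reach n k t ≡ reachWithin (succs n) k t
reach≡reachWithin n zero    t = refl
reach≡reachWithin n (suc k) t = cong (t ∷_) (List.concatMap-cong (reach≡reachWithin n k) (succs n t))

leqᵇ-sound : ∀ n lam u v → T (leqᵇ n lam u v) → u ≤[ n ] v
leqᵇ-sound n lam u v u≤v with find (any⁻ (v ≟T_) (reach n (length (Bλ n lam)) u) u≤v)
... | w , w∈ , v≟w rewrite toWitness v≟w | reach≡reachWithin n (length (Bλ n lam)) u =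
  Path⇒Star (proj₂ (proj₂ (reachWithin-sound (succs n) (λ {t} → succs-sound n t) _ u w∈)))

leqᵇ-complete : ∀ n lam {u v ℓ} → Path (Cover n) u v ℓ → ℓ ≤ length (Bλ n lam) → T (leqᵇ n lam u v)
leqᵇ-complete n lam {u} {v} path ℓ≤ = any⁺ (v ≟T_) (lose v∈ (fromWitness refl))
  where
  v∈ : v ∈ reach n (length (Bλ n lam)) u
  v∈ rewrite reach≡reachWithin n (length (Bλ n lam)) u =
    reachWithin-complete (succs n) (λ {t} → succs-complete n t) _ u path ℓ≤

words-complete : ∀ n {r} → All (InRange n) r → r ∈ words n (length r)
words-complete n []                     = here refl
words-complete n {suc x ∷ r} ((_ , x<n) ∷ ok) =
  subst (suc x ∷ r ∈_) (sym (concatMap-map-∷ (map suc (upTo n)) (words n (length r)))) $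
  ∈-cartesianProductWith⁺ _∷_ (∈-map⁺ suc (∈-upTo⁺ x<n)) (words-complete n ok)

fillings-complete : ∀ n {t} → All (All (InRange n)) t → t ∈ fillings n (map length t)
fillings-complete n []                    = here refl
fillings-complete n {r ∷ t} (ok ∷ oks) =
  subst (r ∷ t ∈_) (sym (concatMap-map-∷ (words n (length r)) (fillings n (map length t)))) $
  ∈-cartesianProductWith⁺ _∷_ (words-complete n ok) (fillings-complete n oks)

InB⇒∈Bλ : ∀ n lam t → InB n lam t → t ∈ Bλ n lam
InB⇒∈Bλ n lam t inB =
  ∈-filter⁺ (T? ∘ isSSYT n lam) (subst (λ lam → t ∈ fillings n lam) shape (fillings-complete n entries)) inB
  where
  parts = Equivalence.to (T-∧ {eqListℕ (map length t) lam}) inB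
  shape : map length t ≡ lam
  shape = toWitness (proj₁ parts)
  inRange : ∀ x → T ((1 ℕ.≤ᵇ x) ∧ (x ℕ.≤ᵇ n)) → InRange n x
  inRange x ok = let 1≤x , x≤n = Equivalence.to (T-∧ {1 ℕ.≤ᵇ x}) ok in ℕ.≤ᵇ⇒≤ 1 x 1≤x , ℕ.≤ᵇ⇒≤ x n x≤n
  rowsInRange = proj₁ (Equivalence.to (T-∧ {all (all (λ x → (1 ℕ.≤ᵇ x) ∧ (x ℕ.≤ᵇ n))) t}) (proj₂ parts))
  entries : All (All (InRange n)) t
  entries = All.map (λ {r} ok → All.map (λ {x} → inRange x) (AllP.all⁺ _ r ok)) (AllP.all⁺ _ t rowsInRange)

Bλ-unique : ∀ n lam → Unique (Bλ n lam)
Bλ-unique n lam = Unique.filter⁺ (T? ∘ isSSYT n lam) (fillings-unique lam)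
  where
  words-unique : ∀ k → Unique (words n k)
  words-unique zero    = [] ∷ []
  words-unique (suc k) = subst Unique (sym (concatMap-map-∷ (map suc (upTo n)) (words n k)))
    (cartesianProduct∷-unique (Unique.map⁺ ℕ.suc-injective (Unique.upTo⁺ n)) (words-unique k))
  fillings-unique : ∀ lam → Unique (fillings n lam)
  fillings-unique []       = [] ∷ []
  fillings-unique (k ∷ ks) = subst Unique (sym (concatMap-map-∷ (words n k) (fillings n ks)))
    (cartesianProduct∷-unique (words-unique k) (fillings-unique ks))

IntervalBelow : ℕ → List ℕ → Tableau → Tableau → Tableau → Bool
IntervalBelow n lam u v z = leqᵇ n lam u z ∧ leqᵇ n lam z v ∧ not (z ≟T v)

IntervalBelow-intro : ∀ {n lam u v z} → T (leqᵇ n lam u z) → T (leqᵇ n lam z v) → z ≢ v → T (IntervalBelow n lam u v z)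
IntervalBelow-intro {n} {lam} {u} {v} {z} u≤z z≤v z≢v =
  Equivalence.from (T-∧ {leqᵇ n lam u z}) (u≤z , Equivalence.from (T-∧ {leqᵇ n lam z v}) (z≤v , fromWitnessFalse z≢v))

IntervalBelow-elim : ∀ {n lam u v z} → T (IntervalBelow n lam u v z) → T (leqᵇ n lam u z) × T (leqᵇ n lam z v) × z ≢ v
IntervalBelow-elim {n} {lam} {u} {v} {z} below =
  let u≤z , rest = Equivalence.to (T-∧ {leqᵇ n lam u z}) below
      z≤v , z≢v  = Equivalence.to (T-∧ {leqᵇ n lam z v}) rest
  in u≤z , z≤v , toWitnessFalse z≢v

muF-refl : ∀ n lam k u → muF n lam (suc k) u u ≡ 1ℤ
muF-refl n lam k u with u ≟T u in eq
... | true  = refl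
... | false = contradiction refl (toWitnessFalse (subst (T ∘ not) (sym eq) _))

muF-< : ∀ n lam k {u v} → u ≢ v → T (leqᵇ n lam u v) →
  muF n lam (suc k) u v ≡ - sumℤ (map (muF n lam k u) (filterᵇ (IntervalBelow n lam u v) (Bλ n lam)))
muF-< n lam k {u} {v} u≢v u≤v with u ≟T v in eq
... | true  = contradiction (toWitness (subst T (sym eq) _)) u≢v
... | false with leqᵇ n lam u v
...   | true = refl

-- The gadget

_≟ᶜ_ : DecidableEquality (List Column)
_≟ᶜ_ = List.≡-dec (×-≡-dec ℕ._≟_ ℕ._≟_)

open import Data.List.Membership.DecPropositional _≟ᶜ_ using (_∈?_)
open import Data.List.Relation.Unary.Unique.DecPropositional _≟ᶜ_ using (unique?)

operators₄ : List ℕ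
operators₄ = 1 ∷ 2 ∷ 3 ∷ []

∈operators₄ : ∀ {i} → 1 ≤ i → i ≤ 3 → i ∈ operators₄
∈operators₄ {1} _ _ = here refl
∈operators₄ {2} _ _ = there (here refl)
∈operators₄ {3} _ _ = there (there (here refl))
∈operators₄ {suc (suc (suc (suc _)))} _ (s≤s (s≤s (s≤s ())))

operators₄-bounds : ∀ {i} → i ∈ operators₄ → 1 ≤ i × i ≤ 3
operators₄-bounds (here refl)                 = s≤s z≤n , s≤s z≤n
operators₄-bounds (there (here refl))         = s≤s z≤n , s≤s (s≤s z≤n)
operators₄-bounds (there (there (here refl))) = s≤s z≤n , s≤s (s≤s (s≤s z≤n))

successors₄ : List Column → List (List Column)
successors₄ g = mapMaybe (λ i → fCols i g) operators₄

successors₄-sound : ∀ {g g′} → g′ ∈ successors₄ g → Cover₄ g g′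
successors₄-sound {g} g′∈ with i , i∈ , eq ← ∈-mapMaybe⁻ (λ i → fCols i g) operators₄ g′∈ =
  i , proj₁ (operators₄-bounds i∈) , proj₂ (operators₄-bounds i∈) , eq

gadgetBottom : List Column
gadgetBottom = (1 , 2) ∷ (1 , 3) ∷ (2 , 4) ∷ []

gadgetTop : List Column
gadgetTop = (1 , 3) ∷ (2 , 4) ∷ (3 , 4) ∷ []

-- The 30 tableaux of B(3,3) for n = 4 that lie above gadgetBottom, as lists of columns (top , bottom).
gadgetCrystal : List (List Column)
gadgetCrystal =
  ((1 , 2) ∷ (1 , 3) ∷ (2 , 4) ∷ [])
  ∷ ((1 , 2) ∷ (1 , 4) ∷ (2 , 4) ∷ [])
  ∷ ((1 , 3) ∷ (1 , 3) ∷ (2 , 4) ∷ [])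
  ∷ ((1 , 3) ∷ (1 , 4) ∷ (2 , 4) ∷ [])
  ∷ ((1 , 4) ∷ (1 , 4) ∷ (2 , 4) ∷ [])
  ∷ ((1 , 2) ∷ (1 , 4) ∷ (3 , 4) ∷ [])
  ∷ ((1 , 3) ∷ (1 , 4) ∷ (3 , 4) ∷ [])
  ∷ ((1 , 4) ∷ (1 , 4) ∷ (3 , 4) ∷ [])
  ∷ ((1 , 2) ∷ (2 , 3) ∷ (2 , 4) ∷ [])
  ∷ ((1 , 2) ∷ (2 , 4) ∷ (2 , 4) ∷ [])
  ∷ ((1 , 3) ∷ (2 , 3) ∷ (2 , 4) ∷ [])
  ∷ ((1 , 3) ∷ (2 , 4) ∷ (2 , 4) ∷ [])
  ∷ ((1 , 4) ∷ (2 , 4) ∷ (2 , 4) ∷ [])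
  ∷ ((1 , 2) ∷ (2 , 3) ∷ (3 , 4) ∷ [])
  ∷ ((1 , 2) ∷ (2 , 4) ∷ (3 , 4) ∷ [])
  ∷ ((1 , 3) ∷ (2 , 3) ∷ (3 , 4) ∷ [])
  ∷ ((1 , 3) ∷ (2 , 4) ∷ (3 , 4) ∷ [])
  ∷ ((1 , 4) ∷ (2 , 4) ∷ (3 , 4) ∷ [])
  ∷ ((1 , 2) ∷ (3 , 4) ∷ (3 , 4) ∷ [])
  ∷ ((1 , 3) ∷ (3 , 4) ∷ (3 , 4) ∷ [])
  ∷ ((1 , 4) ∷ (3 , 4) ∷ (3 , 4) ∷ [])
  ∷ ((2 , 3) ∷ (2 , 3) ∷ (2 , 4) ∷ [])
  ∷ ((2 , 3) ∷ (2 , 4) ∷ (2 , 4) ∷ [])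
  ∷ ((2 , 4) ∷ (2 , 4) ∷ (2 , 4) ∷ [])
  ∷ ((2 , 3) ∷ (2 , 3) ∷ (3 , 4) ∷ [])
  ∷ ((2 , 3) ∷ (2 , 4) ∷ (3 , 4) ∷ [])
  ∷ ((2 , 4) ∷ (2 , 4) ∷ (3 , 4) ∷ [])
  ∷ ((2 , 3) ∷ (3 , 4) ∷ (3 , 4) ∷ [])
  ∷ ((2 , 4) ∷ (3 , 4) ∷ (3 , 4) ∷ [])
  ∷ ((3 , 4) ∷ (3 , 4) ∷ (3 , 4) ∷ [])
  ∷ []

gadgetCrystal-closed : ∀ {g g′} → g ∈ gadgetCrystal → Cover₄ g g′ → g′ ∈ gadgetCrystal
gadgetCrystal-closed g∈ (i , 1≤i , i≤3 , eq) =
  MaybeAll.drop-just (subst (MaybeAll (_∈ gadgetCrystal)) eq (All.lookup (All.lookup closed g∈) (∈operators₄ 1≤i i≤3)))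
  where
  closed : All (λ g → All (λ i → MaybeAll (_∈ gadgetCrystal) (fCols i g)) operators₄) gadgetCrystal
  closed = from-yes (All.all? (λ g → All.all? (λ i → MaybeAll.dec (_∈? gadgetCrystal) (fCols i g)) operators₄) gadgetCrystal)

gadgetCrystal-alphabet : ∀ {g} → g ∈ gadgetCrystal → InAlphabet4 g
gadgetCrystal-alphabet = All.lookup (from-yes (All.all? (All.all? λ (a , b) → letter4? a ×-dec letter4? b) gadgetCrystal))
  where
  letter4? : ∀ x → Dec (InRange 4 x)
  letter4? x = (1 ℕ.≤? x) ×-dec (x ℕ.≤? 4)

gadgetCrystal-width : ∀ {g} → g ∈ gadgetCrystal → length g ≡ 3
gadgetCrystal-width = All.lookup (from-yes (All.all? (λ g → length g ℕ.≟ 3) gadgetCrystal))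

gadgetCrystal-rows : ∀ {g} → g ∈ gadgetCrystal → AllPairs _≼_ g
gadgetCrystal-rows =
  All.lookup (from-yes (All.all? (AllPairs.allPairs? λ (a , b) (c , d) → (a ℕ.≤? c) ×-dec (b ℕ.≤? d)) gadgetCrystal))

gadgetCrystal-columns : ∀ {g} → g ∈ gadgetCrystal → All ColumnStrict g
gadgetCrystal-columns = All.lookup (from-yes (All.all? (All.all? λ (a , b) → a ℕ.<? b) gadgetCrystal))

GadgetList : List (List Column) → Set
GadgetList = All (_∈ gadgetCrystal)

gadgetList-alphabet : ∀ {gs} → GadgetList gs → All InAlphabet4 gs
gadgetList-alphabet = All.map gadgetCrystal-alphabet

gadgetList-widths : ∀ {gs hs} → GadgetList gs → GadgetList hs → length gs ≡ length hs →
  Pointwise (λ g h → length g ≡ length h) gs hs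
gadgetList-widths {[]}    {[]}    []         []         _     = []
gadgetList-widths {_ ∷ _} {_ ∷ _} (g∈ ∷ gs∈) (h∈ ∷ hs∈) len≡ =
  trans (gadgetCrystal-width g∈) (sym (gadgetCrystal-width h∈)) ∷ gadgetList-widths gs∈ hs∈ (ℕ.suc-injective len≡)

blockTableau-injective : ∀ {gs hs} → GadgetList gs → GadgetList hs → length gs ≡ length hs →
  blockTableau gs ≡ blockTableau hs → gs ≡ hs
blockTableau-injective gs∈ hs∈ len≡ = blocks-injective 0 (gadgetList-widths gs∈ hs∈ len≡) ∘ twoRow-injective

length-blocks : ∀ s {gs} → GadgetList gs → length (blocks s gs) ≡ 3 * length gs
length-blocks s []                  = refl
length-blocks s {g ∷ gs} (g∈ ∷ gs∈) = begin
  length (shiftColumns s g ++ blocks (s + 4) gs)      ≡⟨ List.length-++ (shiftColumns s g) ⟩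
  length (shiftColumns s g) + length (blocks (s + 4) gs)
    ≡⟨ cong₂ _+_ (trans (List.length-map _ g) (gadgetCrystal-width g∈)) (length-blocks (s + 4) gs∈) ⟩
  3 + 3 * length gs                                   ≡⟨ ℕ.*-suc 3 (length gs) ⟨
  3 * suc (length gs)                                 ∎
  where open ≡-Reasoning

blocks-rows : ∀ s {gs} → GadgetList gs → AllPairs _≼_ (blocks s gs)
blocks-rows s []                  = []
blocks-rows s {g ∷ gs} (g∈ ∷ gs∈) = AllPairsP.++⁺ shiftedRows (blocks-rows (s + 4) gs∈) below
  where
  shiftedRows : AllPairs _≼_ (shiftColumns s g)
  shiftedRows =
    AllPairsP.map⁺ (AllPairs.map (λ (a≤c , b≤d) → ℕ.+-monoʳ-≤ s a≤c , ℕ.+-monoʳ-≤ s b≤d) (gadgetCrystal-rows g∈))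
  below : All (λ c → All (c ≼_) (blocks (s + 4) gs)) (shiftColumns s g)
  below = All.map (λ (a≤ , b≤) → All.map (λ (<c , <d) → ℕ.≤-trans a≤ (ℕ.<⇒≤ <c) , ℕ.≤-trans b≤ (ℕ.<⇒≤ <d)) later)
                  (mapEntries proj₂ (shiftColumns-bounds s (gadgetCrystal-alphabet g∈)))
    where
    later = mapEntries proj₁ (blocks-bounds (s + 4) gs (gadgetList-alphabet gs∈))

blocks-columns : ∀ s {gs} → GadgetList gs → All ColumnStrict (blocks s gs)
blocks-columns s []                  = []
blocks-columns s {g ∷ gs} (g∈ ∷ gs∈) =
  AllP.++⁺ (AllP.map⁺ (All.map (ℕ.+-monoʳ-< s) (gadgetCrystal-columns g∈))) (blocks-columns (s + 4) gs∈)

InB-blockTableau : ∀ {gs} → GadgetList gs → InB (4 * length gs) (3 * length gs ∷ 3 * length gs ∷ []) (blockTableau gs)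
InB-blockTableau {gs} gs∈ = subst (λ L → InB (4 * length gs) (L ∷ L ∷ []) (blockTableau gs)) (length-blocks 0 gs∈)
  (InB-twoRow _ (blocks 0 gs) (blocks-bounds 0 gs (gadgetList-alphabet gs∈)) (blocks-rows 0 gs∈) (blocks-columns 0 gs∈))

blocks-convex : ∀ n gs → n ≡ 4 * length gs → GadgetList gs → ∀ {z} → Star (Cover n) (blockTableau gs) z →
  ∀ {hs} → GadgetList hs → length hs ≡ length gs → Star (Cover n) z (blockTableau hs) →
  ∃ λ gs′ → GadgetList gs′ × z ≡ blockTableau gs′ × Pointwise (Star Cover₄) gs gs′
blocks-convex n gs n≡ gs∈ ε hs∈ len≡ back = gs , gs∈ , refl , Pointwise.refl ε
blocks-convex n gs refl gs∈ (cover ◅ steps) {hs} hs∈ len≡ back with cover-blocks gs (gadgetList-alphabet gs∈) cover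
... | inj₁ (cs′ , refl , jump) =
  -- the potential jumps at the boundary step but is the same at both ends
  contradiction (ℕ.<-≤-trans jump (ℕ.≤-trans (star-potential (steps ◅◅ back)) (ℕ.≤-reflexive same))) (ℕ.<-irrefl refl)
  where
  same : potential (blocks 0 hs) ≡ potential (blocks 0 gs)
  same = potential-blocks 0 (gadgetList-alphabet hs∈) (gadgetList-alphabet gs∈) (gadgetList-widths hs∈ gs∈ len≡)
... | inj₂ (as , bs , g , g′ , refl , cov , refl) =
  let gs′ , gs′∈ , z≡ , pw = blocks-convex n (as ++ g′ ∷ bs) (cong (4 *_) (length-middle as bs))
                               (All-middle as bs gs∈ (gadgetCrystal-closed (All-middle-lookup as bs gs∈) cov)) steps hs∈
                               (trans len≡ (length-middle as bs)) back
  in gs′ , gs′∈ , z≡ , Pointwise.transitive _◅◅_ (Pointwise.++⁺ (Pointwise.refl ε) ((cov ◅ ε) ∷ Pointwise.refl ε)) pw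

gadgetInterval : List (List Column)
gadgetInterval =
  ((1 , 2) ∷ (1 , 3) ∷ (2 , 4) ∷ [])
  ∷ ((1 , 2) ∷ (1 , 4) ∷ (2 , 4) ∷ [])
  ∷ ((1 , 3) ∷ (1 , 3) ∷ (2 , 4) ∷ [])
  ∷ ((1 , 3) ∷ (1 , 4) ∷ (2 , 4) ∷ [])
  ∷ ((1 , 2) ∷ (1 , 4) ∷ (3 , 4) ∷ [])
  ∷ ((1 , 3) ∷ (1 , 4) ∷ (3 , 4) ∷ [])
  ∷ ((1 , 2) ∷ (2 , 3) ∷ (2 , 4) ∷ [])
  ∷ ((1 , 3) ∷ (2 , 3) ∷ (2 , 4) ∷ [])
  ∷ ((1 , 3) ∷ (2 , 4) ∷ (2 , 4) ∷ [])
  ∷ ((1 , 2) ∷ (2 , 3) ∷ (3 , 4) ∷ [])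
  ∷ ((1 , 3) ∷ (2 , 3) ∷ (3 , 4) ∷ [])
  ∷ ((1 , 3) ∷ (2 , 4) ∷ (3 , 4) ∷ [])
  ∷ []

-- gadgetIdeal g = [gadgetBottom, g]; the table is certified by the decided facts below.
gadgetIdeal : List Column → List (List Column)
gadgetIdeal ((1 , 2) ∷ (1 , 3) ∷ (2 , 4) ∷ []) =
    ((1 , 2) ∷ (1 , 3) ∷ (2 , 4) ∷ [])
  ∷ []
gadgetIdeal ((1 , 2) ∷ (1 , 4) ∷ (2 , 4) ∷ []) =
    ((1 , 2) ∷ (1 , 3) ∷ (2 , 4) ∷ [])
  ∷ ((1 , 2) ∷ (1 , 4) ∷ (2 , 4) ∷ [])
  ∷ []
gadgetIdeal ((1 , 3) ∷ (1 , 3) ∷ (2 , 4) ∷ []) =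
    ((1 , 2) ∷ (1 , 3) ∷ (2 , 4) ∷ [])
  ∷ ((1 , 3) ∷ (1 , 3) ∷ (2 , 4) ∷ [])
  ∷ []
gadgetIdeal ((1 , 3) ∷ (1 , 4) ∷ (2 , 4) ∷ []) =
    ((1 , 2) ∷ (1 , 3) ∷ (2 , 4) ∷ [])
  ∷ ((1 , 3) ∷ (1 , 3) ∷ (2 , 4) ∷ [])
  ∷ ((1 , 3) ∷ (1 , 4) ∷ (2 , 4) ∷ [])
  ∷ []
gadgetIdeal ((1 , 2) ∷ (1 , 4) ∷ (3 , 4) ∷ []) =
    ((1 , 2) ∷ (1 , 3) ∷ (2 , 4) ∷ [])
  ∷ ((1 , 2) ∷ (1 , 4) ∷ (2 , 4) ∷ [])
  ∷ ((1 , 2) ∷ (1 , 4) ∷ (3 , 4) ∷ [])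
  ∷ []
gadgetIdeal ((1 , 3) ∷ (1 , 4) ∷ (3 , 4) ∷ []) =
    ((1 , 2) ∷ (1 , 3) ∷ (2 , 4) ∷ [])
  ∷ ((1 , 2) ∷ (1 , 4) ∷ (2 , 4) ∷ [])
  ∷ ((1 , 2) ∷ (1 , 4) ∷ (3 , 4) ∷ [])
  ∷ ((1 , 3) ∷ (1 , 4) ∷ (3 , 4) ∷ [])
  ∷ []
gadgetIdeal ((1 , 2) ∷ (2 , 3) ∷ (2 , 4) ∷ []) =
    ((1 , 2) ∷ (1 , 3) ∷ (2 , 4) ∷ [])
  ∷ ((1 , 2) ∷ (2 , 3) ∷ (2 , 4) ∷ [])
  ∷ []
gadgetIdeal ((1 , 3) ∷ (2 , 3) ∷ (2 , 4) ∷ []) =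
    ((1 , 2) ∷ (1 , 3) ∷ (2 , 4) ∷ [])
  ∷ ((1 , 3) ∷ (1 , 3) ∷ (2 , 4) ∷ [])
  ∷ ((1 , 3) ∷ (2 , 3) ∷ (2 , 4) ∷ [])
  ∷ []
gadgetIdeal ((1 , 3) ∷ (2 , 4) ∷ (2 , 4) ∷ []) =
    ((1 , 2) ∷ (1 , 3) ∷ (2 , 4) ∷ [])
  ∷ ((1 , 3) ∷ (1 , 3) ∷ (2 , 4) ∷ [])
  ∷ ((1 , 3) ∷ (1 , 4) ∷ (2 , 4) ∷ [])
  ∷ ((1 , 3) ∷ (2 , 3) ∷ (2 , 4) ∷ [])
  ∷ ((1 , 3) ∷ (2 , 4) ∷ (2 , 4) ∷ [])
  ∷ []
gadgetIdeal ((1 , 2) ∷ (2 , 3) ∷ (3 , 4) ∷ []) =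
    ((1 , 2) ∷ (1 , 3) ∷ (2 , 4) ∷ [])
  ∷ ((1 , 2) ∷ (2 , 3) ∷ (2 , 4) ∷ [])
  ∷ ((1 , 2) ∷ (2 , 3) ∷ (3 , 4) ∷ [])
  ∷ []
gadgetIdeal ((1 , 3) ∷ (2 , 3) ∷ (3 , 4) ∷ []) =
    ((1 , 2) ∷ (1 , 3) ∷ (2 , 4) ∷ [])
  ∷ ((1 , 2) ∷ (2 , 3) ∷ (2 , 4) ∷ [])
  ∷ ((1 , 2) ∷ (2 , 3) ∷ (3 , 4) ∷ [])
  ∷ ((1 , 3) ∷ (2 , 3) ∷ (3 , 4) ∷ [])
  ∷ []
gadgetIdeal ((1 , 3) ∷ (2 , 4) ∷ (3 , 4) ∷ []) = gadgetInterval
gadgetIdeal _ = []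

-- μ(gadgetBottom, g), certified by gadgetμ-sum.
gadgetμ : List Column → ℤ
gadgetμ ((1 , 2) ∷ (1 , 3) ∷ (2 , 4) ∷ []) = 1ℤ
gadgetμ ((1 , 2) ∷ (1 , 4) ∷ (2 , 4) ∷ []) = -1ℤ
gadgetμ ((1 , 3) ∷ (1 , 3) ∷ (2 , 4) ∷ []) = -1ℤ
gadgetμ ((1 , 2) ∷ (2 , 3) ∷ (2 , 4) ∷ []) = -1ℤ
gadgetμ ((1 , 3) ∷ (2 , 4) ∷ (3 , 4) ∷ []) = ℤ.+ 2
gadgetμ _                                  = 0ℤ

δ : List Column → ℤ
δ g = if does (g ≟ᶜ gadgetBottom) then 1ℤ else 0ℤ

gadgetRank : List Column → ℕ
gadgetRank g = entrySum g ∸ entrySum gadgetBottom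
  where
  entrySum : List Column → ℕ
  entrySum g = sum (map (λ (a , b) → a + b) g)

gadgetInterval⊆crystal : ∀ {g} → g ∈ gadgetInterval → g ∈ gadgetCrystal
gadgetInterval⊆crystal = All.lookup (from-yes (All.all? (_∈? gadgetCrystal) gadgetInterval))

gadgetInterval-unique : Unique gadgetInterval
gadgetInterval-unique = from-yes (unique? gadgetInterval)

gadgetIdeal⊆interval : ∀ {g} → g ∈ gadgetInterval → All (_∈ gadgetInterval) (gadgetIdeal g)
gadgetIdeal⊆interval =
  All.lookup (from-yes (All.all? (λ g → All.all? (_∈? gadgetInterval) (gadgetIdeal g)) gadgetInterval))

gadgetIdeal-unique : ∀ {g} → g ∈ gadgetInterval → Unique (gadgetIdeal g)
gadgetIdeal-unique = All.lookup (from-yes (All.all? (λ g → unique? (gadgetIdeal g)) gadgetInterval))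

gadgetIdeal-path : ∀ {g} → g ∈ gadgetInterval → All (λ x → ShortPath x g) (gadgetIdeal g)
gadgetIdeal-path {g} g∈ =
  All.map (reachWithin-sound successors₄ (λ {x} → successors₄-sound {x}) 4 _) (All.lookup reachable g∈)
  where
  reachable : All (λ g → All (λ x → g ∈ reachWithin successors₄ 4 x) (gadgetIdeal g)) gadgetInterval
  reachable =
    from-yes (All.all? (λ g → All.all? (λ x → g ∈? reachWithin successors₄ 4 x) (gadgetIdeal g)) gadgetInterval)

gadgetIdeal-refl : ∀ {g} → g ∈ gadgetInterval → g ∈ gadgetIdeal g
gadgetIdeal-refl = All.lookup (from-yes (All.all? (λ g → g ∈? gadgetIdeal g) gadgetInterval))

gadgetIdeal-bottom : ∀ {g} → g ∈ gadgetInterval → gadgetBottom ∈ gadgetIdeal g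
gadgetIdeal-bottom = All.lookup (from-yes (All.all? (λ g → gadgetBottom ∈? gadgetIdeal g) gadgetInterval))

gadgetμ-sum : ∀ {g} → g ∈ gadgetInterval → sumℤ (map gadgetμ (gadgetIdeal g)) ≡ δ g
gadgetμ-sum = All.lookup (from-yes (All.all? (λ g → sumℤ (map gadgetμ (gadgetIdeal g)) ℤ.≟ δ g) gadgetInterval))

gadgetIdeal-rank : ∀ {g} → g ∈ gadgetInterval → All (λ x → x ≡ g ⊎ gadgetRank x < gadgetRank g) (gadgetIdeal g)
gadgetIdeal-rank = All.lookup (from-yes (All.all?
  (λ g → All.all? (λ x → (x ≟ᶜ g) ⊎-dec (gadgetRank x ℕ.<? gadgetRank g)) (gadgetIdeal g)) gadgetInterval))

gadgetIdeal-downClosed : ∀ {g x y} → g ∈ gadgetInterval → x ∈ gadgetCrystal → Cover₄ x y →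
  y ∈ gadgetIdeal g → x ∈ gadgetIdeal g
gadgetIdeal-downClosed g∈ x∈ (i , 1≤i , i≤3 , eq) =
  All.lookup (MaybeAll.drop-just (subst (MaybeAll _) eq (All.lookup (All.lookup closed x∈) (∈operators₄ 1≤i i≤3)))) g∈
  where
  closed = from-yes (All.all? (λ x → All.all? (λ i → MaybeAll.dec (λ y → All.all? (λ g →
             (y ∈? gadgetIdeal g) →-dec (x ∈? gadgetIdeal g)) gadgetInterval) (fCols i x)) operators₄) gadgetCrystal)

gadgetIdeal-star : ∀ {g x} → g ∈ gadgetInterval → x ∈ gadgetCrystal → Star Cover₄ x g → x ∈ gadgetIdeal g
gadgetIdeal-star g∈ x∈ ε                = gadgetIdeal-refl g∈
gadgetIdeal-star g∈ x∈ (cover ◅ covers) =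
  gadgetIdeal-downClosed g∈ x∈ cover (gadgetIdeal-star g∈ (gadgetCrystal-closed x∈ cover) covers)

-- Products of gadget intervals

_≟ᴸ_ : DecidableEquality (List (List Column))
_≟ᴸ_ = List.≡-dec _≟ᶜ_

_≟ᵀ_ : DecidableEquality Tableau
_≟ᵀ_ = List.≡-dec (List.≡-dec ℕ._≟_)

productμ : List (List Column) → ℤ
productμ gs = productℤ (map gadgetμ gs)

rank : List (List Column) → ℕ
rank gs = sum (map gadgetRank gs)

strictLower : List (List Column) → List (List (List Column))
strictLower gs = filter (λ hs → ¬? (hs ≟ᴸ gs)) (choices (map gadgetIdeal gs))

productℤ-δ : ∀ gs → gs ≢ replicate (length gs) gadgetBottom → productℤ (map δ gs) ≡ 0ℤ
productℤ-δ []       gs≢ = contradiction refl gs≢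
productℤ-δ (g ∷ gs) gs≢ with g ≟ᶜ gadgetBottom
... | yes refl = trans (ℤ.*-identityˡ (productℤ (map δ gs))) (productℤ-δ gs (gs≢ ∘ cong (gadgetBottom ∷_)))
... | no _     = ℤ.*-zeroˡ (productℤ (map δ gs))

InIdeals : List (List Column) → List (List Column) → Set
InIdeals = Pointwise (λ h g → h ∈ gadgetIdeal g)

strictLower⁻ : ∀ {gs hs} → hs ∈ strictLower gs → InIdeals hs gs × hs ≢ gs
strictLower⁻ {gs} hs∈ =
  let hs∈choices , hs≢gs = ∈-filter⁻ (λ hs → ¬? (hs ≟ᴸ gs)) {xs = choices (map gadgetIdeal gs)} hs∈
  in Pointwise-map⁻ʳ (∈-choices⁻ _ hs∈choices) , hs≢gs

InIdeals-refl : ∀ {gs} → All (_∈ gadgetInterval) gs → InIdeals gs gs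
InIdeals-refl []          = []
InIdeals-refl (g∈ ∷ gs∈) = gadgetIdeal-refl g∈ ∷ InIdeals-refl gs∈

gadgetIdeals-unique : ∀ {gs} → All (_∈ gadgetInterval) gs → All Unique (map gadgetIdeal gs)
gadgetIdeals-unique []          = []
gadgetIdeals-unique (g∈ ∷ gs∈) = gadgetIdeal-unique g∈ ∷ gadgetIdeals-unique gs∈

stars⇒InIdeals : ∀ {gs hs} → All (_∈ gadgetInterval) gs → GadgetList hs → Pointwise (Star Cover₄) hs gs → InIdeals hs gs
stars⇒InIdeals []          []          []               = []
stars⇒InIdeals (g∈ ∷ gs∈) (h∈ ∷ hs∈) (steps ∷ stepss) =
  gadgetIdeal-star g∈ h∈ steps ∷ stars⇒InIdeals gs∈ hs∈ stepss

InIdeals⇒interval : ∀ {gs hs} → All (_∈ gadgetInterval) gs → InIdeals hs gs → All (_∈ gadgetInterval) hs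
InIdeals⇒interval []          []          = []
InIdeals⇒interval (g∈ ∷ gs∈) (h∈ ∷ hs∈) = All.lookup (gadgetIdeal⊆interval g∈) h∈ ∷ InIdeals⇒interval gs∈ hs∈

InIdeals⇒shortPaths : ∀ {gs hs} → All (_∈ gadgetInterval) gs → InIdeals hs gs → Pointwise ShortPath hs gs
InIdeals⇒shortPaths []          []          = []
InIdeals⇒shortPaths (g∈ ∷ gs∈) (h∈ ∷ hs∈) = All.lookup (gadgetIdeal-path g∈) h∈ ∷ InIdeals⇒shortPaths gs∈ hs∈

strictLower-rank : ∀ {gs hs} → All (_∈ gadgetInterval) gs → hs ∈ strictLower gs → rank hs < rank gs
strictLower-rank gs∈ hs∈ = let hs-ideal , hs≢gs = strictLower⁻ hs∈ in rank-< (lower gs∈ hs-ideal) hs≢gs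
  where
  Lower : List Column → List Column → Set
  Lower h g = h ≡ g ⊎ gadgetRank h < gadgetRank g
  lower : ∀ {gs hs} → All (_∈ gadgetInterval) gs → InIdeals hs gs → Pointwise Lower hs gs
  lower []          []          = []
  lower (g∈ ∷ gs∈) (h∈ ∷ hs∈) = All.lookup (gadgetIdeal-rank g∈) h∈ ∷ lower gs∈ hs∈
  rank-≤ : ∀ {hs gs} → Pointwise Lower hs gs → rank hs ≤ rank gs
  rank-≤ []                = z≤n
  rank-≤ (inj₁ refl ∷ rest) = ℕ.+-monoʳ-≤ _ (rank-≤ rest)
  rank-≤ (inj₂ <g ∷ rest)   = ℕ.+-mono-≤ (ℕ.<⇒≤ <g) (rank-≤ rest)
  rank-< : ∀ {hs gs} → Pointwise Lower hs gs → hs ≢ gs → rank hs < rank gs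
  rank-< []                     hs≢ = contradiction refl hs≢
  rank-< (inj₁ refl ∷ rest) hs≢ = ℕ.+-monoʳ-< _ (rank-< rest (hs≢ ∘ cong (_ ∷_)))
  rank-< (inj₂ <g ∷ rest)   _   = ℕ.+-mono-<-≤ <g (rank-≤ rest)

sumℤ-strictLower : ∀ {gs} → All (_∈ gadgetInterval) gs → gs ≢ replicate (length gs) gadgetBottom →
  sumℤ (map productμ (strictLower gs)) ≡ - productμ gs
sumℤ-strictLower {gs} gs∈ gs≢ = inverseʳ-unique (productμ gs) (sumℤ (map productμ (strictLower gs))) (begin
  sumℤ (map productμ (gs ∷ strictLower gs))
    ≡⟨ sumℤ-↭ (↭.map⁺ productμ (↭-sym
         (unique-∈⇒↭-∷-filter _≟ᴸ_ (choices-unique (gadgetIdeals-unique gs∈)) gs∈choices))) ⟩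
  sumℤ (map productμ (choices (map gadgetIdeal gs)))
    ≡⟨ sumℤ-choices gadgetμ (map gadgetIdeal gs) ⟩
  productℤ (map (sumℤ ∘ map gadgetμ) (map gadgetIdeal gs))
    ≡⟨ cong productℤ (trans (sym (List.map-∘ gs)) (List.map-cong-local (All.map gadgetμ-sum gs∈))) ⟩
  productℤ (map δ gs)
    ≡⟨ productℤ-δ gs gs≢ ⟩
  0ℤ ∎)
  where
  open ≡-Reasoning
  gs∈choices : gs ∈ choices (map gadgetIdeal gs)
  gs∈choices = ∈-choices⁺ (Pointwise-map⁺ʳ (InIdeals-refl gs∈))
  uniques : ∀ {gs} → All (_∈ gadgetInterval) gs → All Unique (map gadgetIdeal gs)
  uniques []          = []
  uniques (g∈ ∷ gs∈) = gadgetIdeal-unique g∈ ∷ uniques gs∈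

module BlockInterval (m : ℕ) where

  n : ℕ
  n = 4 * m

  lam : List ℕ
  lam = 3 * m ∷ 3 * m ∷ []

  B : List Tableau
  B = Bλ n lam

  bottoms : List (List Column)
  bottoms = replicate m gadgetBottom

  u : Tableau
  u = blockTableau bottoms

  Point : List (List Column) → Set
  Point gs = All (_∈ gadgetInterval) gs × length gs ≡ m

  point-gadgets : ∀ {gs} → Point gs → GadgetList gs
  point-gadgets = All.map gadgetInterval⊆crystal ∘ proj₁

  point-InB : ∀ {gs} → Point gs → InB n lam (blockTableau gs)
  point-InB {gs} (gs∈ , refl) = InB-blockTableau (point-gadgets (gs∈ , refl))

  point-injective : ∀ {gs hs} → Point gs → Point hs → blockTableau gs ≡ blockTableau hs → gs ≡ hs
  point-injective pg ph =
    blockTableau-injective (point-gadgets pg) (point-gadgets ph) (trans (proj₂ pg) (sym (proj₂ ph)))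

  bottoms-point : Point bottoms
  bottoms-point = AllP.replicate⁺ m gadgetBottom∈ , List.length-replicate m
    where
    gadgetBottom∈ : gadgetBottom ∈ gadgetInterval
    gadgetBottom∈ = from-yes (gadgetBottom ∈? gadgetInterval)

  -- The fuel length B of leqᵇ and μ has to exceed the length 4m of the chains from u to v.
  length-B : 4 * m ≤ length B
  length-B = ℕ.≤-trans (ℕ.<⇒≤ (4*<product m)) (begin
    product (map length (replicate m gadgetInterval)) ≡⟨ length-choices (replicate m gadgetInterval) ⟨
    length (choices (replicate m gadgetInterval))     ≡⟨ List.length-map blockTableau (choices (replicate m gadgetInterval)) ⟨
    length (map blockTableau (choices (replicate m gadgetInterval)))
      ≤⟨ unique-⊆⇒length≤ _≟ᵀ_ (unique-map⁺ blockTableau point-injective allPoints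
                                    (choices-unique (AllP.replicate⁺ m gadgetInterval-unique)))
                                 (Bλ-unique n lam) ⊆B ⟩
    length B                                          ∎)
    where
    open ℕ.≤-Reasoning
    4*<product : ∀ k → 4 * k < product (map length (replicate k gadgetInterval))
    4*<product zero    = s≤s z≤n
    4*<product (suc k) = ℕ.≤-trans (ℕ.m≤m+n (suc (4 * suc k)) (44 * k + 7))
      (ℕ.≤-trans (ℕ.≤-reflexive (grow k)) (ℕ.*-monoʳ-≤ 12 (4*<product k)))
      where
      grow : ∀ k → suc (4 * suc k) + (44 * k + 7) ≡ 12 * suc (4 * k)
      grow = solve-∀
    allPoints : All Point (choices (replicate m gadgetInterval))
    allPoints = All.tabulate (Pointwise-replicate⁻ ∘ ∈-choices⁻ (replicate m gadgetInterval))
    ⊆B : ∀ {t} → t ∈ map blockTableau (choices (replicate m gadgetInterval)) → t ∈ B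
    ⊆B t∈ with gs , gs∈ , refl ← ∈-map⁻ blockTableau t∈ = InB⇒∈Bλ n lam _ (point-InB (All.lookup allPoints gs∈))

  ≤ᵇ-blocks : ∀ {gs hs} → Point gs → Point hs → Pointwise ShortPath gs hs →
    T (leqᵇ n lam (blockTableau gs) (blockTableau hs))
  ≤ᵇ-blocks {gs} pg@(_ , refl) ph paths
    with ℓ , ℓ≤ , path ← pointwise-lift [] [] (gadgetList-alphabet (point-gadgets pg))
                                           (gadgetList-alphabet (point-gadgets ph)) ℕ.≤-refl paths =
    leqᵇ-complete n lam path (ℕ.≤-trans ℓ≤ length-B)

  bottoms-below : ∀ {gs} → Point gs → Pointwise ShortPath bottoms gs
  bottoms-below (gs∈ , refl) =
    Pointwise-All⁺ (All.map (λ g∈ → All.lookup (gadgetIdeal-path g∈) (gadgetIdeal-bottom g∈)) gs∈)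

  length-above-bottoms : ∀ {hs} → Pointwise (Star Cover₄) bottoms hs → length hs ≡ m
  length-above-bottoms bottoms≤hs = trans (sym (Pointwise.Pointwise-length bottoms≤hs)) (proj₂ bottoms-point)

  interval-blocks : ∀ {gs w} → Point gs → u ≤[ n ] w → w ≤[ n ] blockTableau gs →
    ∃ λ hs → w ≡ blockTableau hs × InIdeals hs gs
  interval-blocks {gs} pg@(gs∈ , len≡) u≤w w≤z
    with hs , hs-g , refl , bottoms≤hs ← blocks-convex n bottoms (cong (4 *_) (sym (proj₂ bottoms-point)))
                                           (point-gadgets bottoms-point) u≤w (point-gadgets pg)
                                           (trans len≡ (sym (proj₂ bottoms-point))) w≤z
    with gs′ , gs′-g , z≡ , hs≤gs′ ← blocks-convex n hs (cong (4 *_) (sym (length-above-bottoms bottoms≤hs))) hs-g w≤z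
                                       (point-gadgets pg) (trans len≡ (sym (length-above-bottoms bottoms≤hs))) ε
    with refl ← blockTableau-injective (point-gadgets pg) gs′-g
                  (trans len≡ (trans (sym (length-above-bottoms bottoms≤hs)) (Pointwise.Pointwise-length hs≤gs′))) z≡
    = hs , refl , stars⇒InIdeals gs∈ hs-g hs≤gs′

  InIdeals⇒point : ∀ {gs hs} → Point gs → InIdeals hs gs → Point hs
  InIdeals⇒point (gs∈ , len≡) hs-ideal = InIdeals⇒interval gs∈ hs-ideal , trans (Pointwise.Pointwise-length hs-ideal) len≡

  strictLowerInterval-↭ : ∀ {gs} → Point gs →
    filterᵇ (IntervalBelow n lam u (blockTableau gs)) B ↭ map blockTableau (strictLower gs)
  strictLowerInterval-↭ {gs} pg@(gs∈ , _) = unique-⇔⇒↭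
    (Unique.filter⁺ (T? ∘ IntervalBelow n lam u z) (Bλ-unique n lam))
    (unique-map⁺ blockTableau point-injective (All.tabulate (λ hs∈ → InIdeals⇒point pg (proj₁ (strictLower⁻ hs∈))))
                 (Unique.filter⁺ _ (choices-unique (gadgetIdeals-unique gs∈))))
    (mk⇔ lower⊆ ⊆lower)
    where
    z = blockTableau gs
    lower⊆ : ∀ {w} → w ∈ filterᵇ (IntervalBelow n lam u z) B → w ∈ map blockTableau (strictLower gs)
    lower⊆ {w} w∈
      with u≤w , w≤z , w≢z ← IntervalBelow-elim {n} {lam} {u} {z} {w}
                                 (proj₂ (∈-filter⁻ (T? ∘ IntervalBelow n lam u z) {xs = B} w∈))
      with hs , refl , hs-ideal ← interval-blocks pg (leqᵇ-sound n lam u w u≤w) (leqᵇ-sound n lam w z w≤z) =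
      ∈-map⁺ blockTableau
        (∈-filter⁺ (λ hs → ¬? (hs ≟ᴸ gs)) (∈-choices⁺ (Pointwise-map⁺ʳ hs-ideal)) (w≢z ∘ cong blockTableau))
    ⊆lower : ∀ {w} → w ∈ map blockTableau (strictLower gs) → w ∈ filterᵇ (IntervalBelow n lam u z) B
    ⊆lower w∈ with hs , hs∈ , refl ← ∈-map⁻ blockTableau w∈
      with hs-ideal , hs≢gs ← strictLower⁻ hs∈ =
      ∈-filter⁺ (T? ∘ IntervalBelow n lam u z) (InB⇒∈Bλ n lam _ (point-InB ph))
        (IntervalBelow-intro {n} {lam} {u} {z} {blockTableau hs} (≤ᵇ-blocks bottoms-point ph (bottoms-below ph))
                             (≤ᵇ-blocks ph pg (InIdeals⇒shortPaths gs∈ hs-ideal))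
                             (hs≢gs ∘ point-injective ph pg))
      where
      ph = InIdeals⇒point pg hs-ideal

  μ-blocks : ∀ k {gs} → Point gs → rank gs < k → muF n lam k u (blockTableau gs) ≡ productμ gs
  μ-blocks (suc k) {gs} pg rank< with gs ≟ᴸ bottoms
  ... | yes refl = trans (muF-refl n lam k u) (sym (productμ-bottoms m))
    where
    productμ-bottoms : ∀ k → productμ (replicate k gadgetBottom) ≡ 1ℤ
    productμ-bottoms zero    = refl
    productμ-bottoms (suc k) = trans (ℤ.*-identityˡ _) (productμ-bottoms k)
  ... | no gs≢ = begin
    muF n lam (suc k) u z
      ≡⟨ muF-< n lam k (gs≢ ∘ sym ∘ point-injective bottoms-point pg) (≤ᵇ-blocks bottoms-point pg (bottoms-below pg)) ⟩
    - sumℤ (map (muF n lam k u) (filterᵇ (IntervalBelow n lam u z) B))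
      ≡⟨ cong -_ (sumℤ-↭ (↭.map⁺ (muF n lam k u) (strictLowerInterval-↭ pg))) ⟩
    - sumℤ (map (muF n lam k u) (map blockTableau (strictLower gs)))
      ≡⟨ cong (-_ ∘ sumℤ) (List.map-∘ (strictLower gs)) ⟨
    - sumℤ (map (muF n lam k u ∘ blockTableau) (strictLower gs))
      ≡⟨ cong -_ (sumℤ-cong (strictLower gs) induction) ⟩
    - sumℤ (map productμ (strictLower gs))
      ≡⟨ cong -_ (sumℤ-strictLower (proj₁ pg) (subst (λ L → gs ≢ replicate L gadgetBottom) (sym (proj₂ pg)) gs≢)) ⟩
    - - productμ gs
      ≡⟨ ℤ.neg-involutive (productμ gs) ⟩
    productμ gs ∎
    where
    open ≡-Reasoning
    z = blockTableau gs
    induction : ∀ {hs} → hs ∈ strictLower gs → muF n lam k u (blockTableau hs) ≡ productμ hs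
    induction hs∈ = μ-blocks k (InIdeals⇒point pg (proj₁ (strictLower⁻ hs∈)))
                      (ℕ.<-≤-trans (strictLower-rank (proj₁ pg) hs∈) (ℕ.≤-pred rank<))

  tops : List (List Column)
  tops = replicate m gadgetTop

  v : Tableau
  v = blockTableau tops

  tops-point : Point tops
  tops-point = AllP.replicate⁺ m (from-yes (gadgetTop ∈? gadgetInterval)) , List.length-replicate m

  u≤v : u ≤[ n ] v
  u≤v = leqᵇ-sound n lam u v (≤ᵇ-blocks bottoms-point tops-point (bottoms-below tops-point))

  μ-u-v : μ n lam u v ≡ ℤ.+ (2 ^ m)
  μ-u-v = trans (μ-blocks (suc (length B)) tops-point (s≤s (ℕ.≤-trans (ℕ.≤-reflexive (rank-tops m)) length-B)))
                (productμ-tops m)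
    where
    rank-tops : ∀ k → rank (replicate k gadgetTop) ≡ 4 * k
    rank-tops zero    = refl
    rank-tops (suc k) = trans (cong (4 +_) (rank-tops k)) (sym (ℕ.*-suc 4 k))
    productμ-tops : ∀ k → productμ (replicate k gadgetTop) ≡ ℤ.+ (2 ^ k)
    productμ-tops zero    = refl
    productμ-tops (suc k) = trans (cong (ℤ.+ 2 *ℤ_) (productμ-tops k)) (sym (ℤ.pos-* 2 (2 ^ k)))

n<2^n : ∀ k → k < 2 ^ k
n<2^n zero    = s≤s z≤n
n<2^n (suc k) = subst (_≤ 2 ^ suc k) (ℕ.+-comm (suc k) 1)
  (ℕ.+-mono-≤ (n<2^n k) (ℕ.≤-trans (ℕ.m^n>0 2 k) (ℕ.m≤m+n (2 ^ k) 0)))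

i≤2^1+∣i∣ : ∀ i → i ℤ.≤ ℤ.+ (2 ^ suc ℤ.∣ i ∣)
i≤2^1+∣i∣ (ℤ.+ k)    = ℤ.+≤+ (ℕ.≤-trans (ℕ.<⇒≤ (n<2^n k)) (ℕ.m≤m+n (2 ^ k) (2 ^ k + 0)))
i≤2^1+∣i∣ ℤ.-[1+ k ] = ℤ.-≤+

theorem7p3 : (N : ℤ) → Σ ℕ λ n → Σ (List ℕ) λ lam → IsPartition lam ×
    Σ Tableau λ u → Σ Tableau λ v →
    InB n lam u × InB n lam v × u ≤[ n ] v × N ℤ.≤ μ n lam u v
theorem7p3 N = n , lam , partition , u , v , point-InB bottoms-point , point-InB tops-point , u≤v ,
  subst (N ℤ.≤_) (sym μ-u-v) (i≤2^1+∣i∣ N)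
  where
  -- one block more than ∣ N ∣, since the parts of a partition are positive
  open BlockInterval (suc ℤ.∣ N ∣)
  partition : IsPartition lam
  partition = Equivalence.from T-∧ (ℕ.≤⇒≤ᵇ (ℕ.≤-refl {3 * suc ℤ.∣ N ∣}) , _)
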